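{- Let $k,n$ be positive integers and let $G$ be a $k$-regular bipartite finite simple graph of order $n$. Then the number of subgraphs of $G$ isomorphic to the cycle $C_4$ and the number of subgraphs of $G$ isomorphic to the path $P_4$ are determined by $Q(G;x,y)$; that is, if $G'$ is another $k$-regular bipartite graph of order $n$ with $Q(G';x,y)=Q(G;x,y)$, then $G$ and $G'$ have the same number of subgraphs isomorphic to $C_4$ and the same number of subgraphs isomorphic to $P_4$.
   Context: For a finite simple graph $G=(V,E)$, the subgraph component polynomial is $Q(G;x,y)=\sum_{X\subseteq V} x^{|X|}y^{k(G[X])}$, where $G[X]$ is the induced subgraph on $X$ and $k(\cdot)$ denotes the number of connected components. $P_4$ is the path on 4 vertices and $C_4$ the cycle on 4 vertices. -}

module Defs where

open import Data.Nat using (ℕ; zero; suc; _+_; _/_; _≡ᵇ_)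
open import Data.Bool using (Bool; true; false; _∧_; _∨_; not; if_then_else_)
open import Data.Fin using (Fin; toℕ; _≟_)
open import Data.Fin.Subset using (Subset)
open import Data.Vec using (Vec; []; _∷_; lookup)
open import Data.List using (List; []; _∷_; map; concatMap; length; filter)
open import Data.Bool.ListAction using (all; any)
open import Data.List using (allFin) renaming (_++_ to _++ₗ_)
open import Data.Product using (∃; _×_; _,_)
open import Relation.Binary.PropositionalEquality using (_≡_; _≢_)
open import Relation.Nullary.Decidable using (⌊_⌋)
open import Data.Nat using (_<ᵇ_)

record Graph (n : ℕ) : Set where
  field
    adj   : Fin n → Fin n → Bool
    sym   : ∀ u v → adj u v ≡ adj v u
    irref : ∀ v → adj v v ≡ false
open Graph public

countB : {A : Set} → (A → Bool) → List A → ℕ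
countB p xs = length (filter (λ x → Data.Bool._≟_ (p x) true) xs)

degree : ∀ {n} → Graph n → Fin n → ℕ
degree G v = countB (λ u → adj G v u) (allFin _)

Regular : ∀ {n} → ℕ → Graph n → Set
Regular k G = ∀ v → degree G v ≡ k

Bipartite : ∀ {n} → Graph n → Set
Bipartite {n} G = ∃ λ (c : Fin n → Bool) → ∀ u v → adj G u v ≡ true → c u ≢ c v

allSubsets : ∀ n → List (Subset n)
allSubsets zero    = [] ∷ []
allSubsets (suc n) = concatMap (λ s → (true ∷ s) ∷ (false ∷ s) ∷ []) (allSubsets n)

size : ∀ {n} → Subset n → ℕ
size {n} X = countB (λ v → lookup X v) (allFin n)

walkIn : ∀ {n} → Graph n → Subset n → ℕ → Fin n → Fin n → Bool
walkIn G X zero    u v = ⌊ u ≟ v ⌋ ∧ lookup X u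
walkIn G X (suc m) u v =
  walkIn G X m u v ∨
  any (λ w → walkIn G X m u w ∧ lookup X v ∧ adj G w v) (allFin _)

-- u and v are in the same connected component of G[X]
-- (walks of length ≤ n suffice on n vertices)
connIn : ∀ {n} → Graph n → Subset n → Fin n → Fin n → Bool
connIn {n} G X = walkIn G X n

-- k(G[X]): number of connected components of G[X], counted as the number
-- of vertices of X that are the least vertex of their component.
components : ∀ {n} → Graph n → Subset n → ℕ
components {n} G X =
  countB (λ v → lookup X v ∧
                not (any (λ u → (toℕ u <ᵇ toℕ v) ∧ connIn G X u v) (allFin n)))
         (allFin n)

-- Coefficient of x^i y^j in Q(G;x,y) = Σ_X x^|X| y^k(G[X]).
Qcoeff : ∀ {n} → Graph n → ℕ → ℕ → ℕ
Qcoeff {n} G i j =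
  countB (λ X → (size X ≡ᵇ i) ∧ (components G X ≡ᵇ j)) (allSubsets n)

SameQ : ∀ {n m} → Graph n → Graph m → Set
SameQ G G' = ∀ i j → Qcoeff G i j ≡ Qcoeff G' i j

allMaps : ∀ m n → List (Vec (Fin n) m)
allMaps zero    n = [] ∷ []
allMaps (suc m) n = concatMap (λ f → map (λ a → a ∷ f) (allFin n)) (allMaps m n)

isInjHom : ∀ {m n} → Graph m → Graph n → Vec (Fin n) m → Bool
isInjHom {m} H G f =
  all (λ i → all (λ j →
        (⌊ i ≟ j ⌋ ∨ not ⌊ lookup f i ≟ lookup f j ⌋) ∧
        (not (adj H i j) ∨ adj G (lookup f i) (lookup f j)))
      (allFin m)) (allFin m)

injHom : ∀ {m n} → Graph m → Graph n → ℕ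
injHom {m} {n} H G = countB (isInjHom H G) (allMaps m n)

-- total division (only used with a nonzero divisor, see below)
_div_ : ℕ → ℕ → ℕ
a div zero    = 0
a div (suc d) = a / suc d

-- number of subgraphs of G isomorphic to H:  inj(H,G) / |Aut(H)|,
-- where |Aut(H)| = inj(H,H) (each such subgraph is the image of exactly
-- |Aut H| injective homomorphisms).
subCount : ∀ {m n} → Graph m → Graph n → ℕ
subCount H G = injHom H G div injHom H H

c4adj : Fin 4 → Fin 4 → Bool
c4adj u v = let a = toℕ u ; b = toℕ v in
  ((a + 1) Data.Nat.% 4 ≡ᵇ b) ∨ ((b + 1) Data.Nat.% 4 ≡ᵇ a)

p4adj : Fin 4 → Fin 4 → Bool
p4adj u v = let a = toℕ u ; b = toℕ v in (a + 1 ≡ᵇ b) ∨ (b + 1 ≡ᵇ a)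

private
  open Data.Fin using (zero; suc)
  open Relation.Binary.PropositionalEquality using (refl)

  c4sym : ∀ u v → c4adj u v ≡ c4adj v u
  c4sym zero zero = refl
  c4sym zero (suc zero) = refl
  c4sym zero (suc (suc zero)) = refl
  c4sym zero (suc (suc (suc zero))) = refl
  c4sym (suc zero) zero = refl
  c4sym (suc zero) (suc zero) = refl
  c4sym (suc zero) (suc (suc zero)) = refl
  c4sym (suc zero) (suc (suc (suc zero))) = refl
  c4sym (suc (suc zero)) zero = refl
  c4sym (suc (suc zero)) (suc zero) = refl
  c4sym (suc (suc zero)) (suc (suc zero)) = refl
  c4sym (suc (suc zero)) (suc (suc (suc zero))) = refl
  c4sym (suc (suc (suc zero))) zero = refl
  c4sym (suc (suc (suc zero))) (suc zero) = refl
  c4sym (suc (suc (suc zero))) (suc (suc zero)) = refl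
  c4sym (suc (suc (suc zero))) (suc (suc (suc zero))) = refl

  p4sym : ∀ u v → p4adj u v ≡ p4adj v u
  p4sym u v = Data.Bool.Properties.∨-comm (toℕ u + 1 ≡ᵇ toℕ v) _
    where import Data.Bool.Properties

  c4irr : ∀ v → c4adj v v ≡ false
  c4irr zero = refl
  c4irr (suc zero) = refl
  c4irr (suc (suc zero)) = refl
  c4irr (suc (suc (suc zero))) = refl

  p4irr : ∀ v → p4adj v v ≡ false
  p4irr zero = refl
  p4irr (suc zero) = refl
  p4irr (suc (suc zero)) = refl
  p4irr (suc (suc (suc zero))) = refl

C4 : Graph 4
C4 = record { adj = c4adj ; sym = c4sym ; irref = c4irr }

P4 : Graph 4
P4 = record { adj = p4adj ; sym = p4sym ; irref = p4irr }

{-# OPTIONS --safe #-}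
module Submission where

-- In a triangle-free graph, four distinct vertices span a connected induced subgraph exactly when
-- that subgraph is P₄, K₁,₃ or C₄. Counting injective homomorphisms over the 24 orderings of every
-- 4-set of vertices therefore gives
--   24·24·q + 9·24·inj(C₄,G) = 12·24·inj(P₄,G) + 4·24·inj(K₁,₃,G),
-- where q is the coefficient of x⁴y in Q(G;x,y). In a k-regular triangle-free graph on n vertices
-- inj(P₄,G) = nk(k−1)² and inj(K₁,₃,G) = nk(k−1)(k−2), so Q, n and k determine inj(C₄,G) as well;
-- dividing by the automorphism counts gives the numbers of subgraphs. Bipartite graphs are
-- triangle-free. Every statement about a single graph on four labelled vertices is checked by
-- evaluation on all 2⁶ edge patterns.

open import Data.Bool using (Bool; true; false; _∧_; _∨_; not; T)
open import Data.Bool.ListAction using (all; any)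
open import Data.Bool.Properties using (∧-identityʳ; ∧-zeroʳ; ∧-distribʳ-∨; ∨-identityʳ; ∨-zeroʳ; ∨-comm; ¬-not; ⇔→≡)
open import Data.Empty using (⊥; ⊥-elim)
open import Data.Fin using (Fin; zero; suc; _≟_; toℕ)
open import Data.Fin.Patterns using (0F; 1F; 2F; 3F)
open import Data.Fin.Properties using (toℕ-injective; injective⇒≤)
import Data.Fin.Properties as Fin
open import Data.Fin.Subset using (Subset)
open import Data.List using (List; []; _∷_; _++_; map; concatMap; tabulate; allFin; length)
open import Data.Nat using (ℕ; zero; suc; _+_; _*_; _∸_; _≤_; _<_; _≡ᵇ_; _<ᵇ_; s≤s; z≤n)
open import Data.Nat.Properties
  using (+-*-semiring; +-identityʳ; *-identityʳ; *-zeroʳ; +-suc; +-assoc; ≤-refl; +-mono-≤; *-distribˡ-+; *-comm;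
         ≡ᵇ⇒≡; m∸n+n≡m; <⇒≤; <-irrefl; *-cancelˡ-≡; +-cancelˡ-≡)
open import Data.Product using (_×_; _,_; ∃; proj₁; proj₂)
open import Data.Vec using (Vec; []; _∷_; lookup)
import Data.Vec as Vec
open import Data.Vec.Properties using (lookup∘tabulate; tabulate∘lookup; tabulate-cong)
open import Function using (_∘_; case_of_)
open import Function.Bundles using (mk⇔)
open import Function.Definitions using (Injective)
open import Relation.Binary.PropositionalEquality
open import Relation.Nullary using (¬_; yes; no)
open import Relation.Nullary.Decidable using (⌊_⌋; isYes≗does; dec-true; dec-false)

open import Algebra.Properties.Semiring.Sum +-*-semiring
  using (sum-syntax; ∑-comm; ∑-distrib-+; sum-cong-≗; *-distribˡ-sum; *-distribʳ-sum)

open import Defs hiding (sym)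

∧-elimˡ : ∀ {x y} → x ∧ y ≡ true → x ≡ true
∧-elimˡ {true} _ = refl

∧-elimʳ : ∀ x {y} → x ∧ y ≡ true → y ≡ true
∧-elimʳ true h = h

_⇒ᵇ_ : Bool → Bool → Bool
x ⇒ᵇ y = not x ∨ y

⇒ᵇ-intro : ∀ {x y} → (x ≡ true → y ≡ true) → x ⇒ᵇ y ≡ true
⇒ᵇ-intro {true}  f = f refl
⇒ᵇ-intro {false} f = refl

⇒ᵇ-elim : ∀ {x y} → x ⇒ᵇ y ≡ true → x ≡ true → y ≡ true
⇒ᵇ-elim h refl = h

_⇔ᵇ_ : Bool → Bool → Bool
true  ⇔ᵇ y = y
false ⇔ᵇ y = not y

⇔ᵇ-sound : ∀ {x y} → x ⇔ᵇ y ≡ true → x ≡ y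
⇔ᵇ-sound {true}  {true}  _ = refl
⇔ᵇ-sound {false} {false} _ = refl

≡ᵇ-sound : ∀ {m n} → (m ≡ᵇ n) ≡ true → m ≡ n
≡ᵇ-sound {m} {n} h = ≡ᵇ⇒≡ m n (subst T (sym h) _)

<ᵇ-irrefl : ∀ m → (m <ᵇ m) ≡ false
<ᵇ-irrefl zero    = refl
<ᵇ-irrefl (suc m) = <ᵇ-irrefl m

<ᵇ-flip : ∀ {m n} → m ≢ n → (n <ᵇ m) ≡ not (m <ᵇ n)
<ᵇ-flip {zero}  {zero}  m≢n = ⊥-elim (m≢n refl)
<ᵇ-flip {zero}  {suc n} m≢n = refl
<ᵇ-flip {suc m} {zero}  m≢n = refl
<ᵇ-flip {suc m} {suc n} m≢n = <ᵇ-flip (m≢n ∘ cong suc)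

<ᵇ-trans : ∀ m n p → (m <ᵇ n) ≡ true → (n <ᵇ p) ≡ true → (m <ᵇ p) ≡ true
<ᵇ-trans zero    (suc n) (suc p) _   _   = refl
<ᵇ-trans (suc m) (suc n) (suc p) m<n n<p = <ᵇ-trans m n p m<n n<p

_==_ : ∀ {n} → Fin n → Fin n → Bool
i == j = ⌊ i ≟ j ⌋

==-refl : ∀ {n} (i : Fin n) → i == i ≡ true
==-refl i = trans (isYes≗does (i ≟ i)) (dec-true (i ≟ i) refl)

==-≢ : ∀ {n} {i j : Fin n} → i ≢ j → i == j ≡ false
==-≢ {i = i} {j} i≢j = trans (isYes≗does (i ≟ j)) (dec-false (i ≟ j) i≢j)

==⇒≡ : ∀ {n} {i j : Fin n} → i == j ≡ true → i ≡ j
==⇒≡ {i = i} {j} h with i ≟ j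
... | yes i≡j = i≡j

not-==⇒≢ : ∀ {n} {i j : Fin n} → not (i == j) ≡ true → i ≢ j
not-==⇒≢ {i = i} h refl rewrite ==-refl i = case h of λ ()

==-sym : ∀ {n} (i j : Fin n) → i == j ≡ j == i
==-sym i j with i ≟ j | j ≟ i
... | yes refl | yes _    = refl
... | no _     | no _     = refl
... | yes refl | no j≢i   = ⊥-elim (j≢i refl)
... | no i≢j   | yes refl = ⊥-elim (i≢j refl)

==-suc : ∀ {n} (i j : Fin n) → suc i == suc j ≡ i == j
==-suc i j = trans (isYes≗does (suc i ≟ suc j)) (sym (isYes≗does (i ≟ j)))

⟦_⟧ : Bool → ℕ
⟦ true  ⟧ = 1
⟦ false ⟧ = 0

⟦∨⟧ : ∀ x y → x ∧ y ≡ false → ⟦ x ∨ y ⟧ ≡ ⟦ x ⟧ + ⟦ y ⟧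
⟦∨⟧ true  false _ = refl
⟦∨⟧ false y     _ = refl

∑-const : ∀ n c → ∑[ i < n ] c ≡ n * c
∑-const zero    c = refl
∑-const (suc n) c = cong (c +_) (∑-const n c)

count : ∀ {n} → (Fin n → Bool) → ℕ
count {n} p = ∑[ i < n ] ⟦ p i ⟧

_∖_ : ∀ {n} → (Fin n → Bool) → Fin n → Fin n → Bool
(p ∖ x) y = p y ∧ not (y == x)

∖-intro : ∀ {n} (p : Fin n → Bool) {x y} → p y ≡ true → y ≢ x → (p ∖ x) y ≡ true
∖-intro p py y≢x = cong₂ _∧_ py (cong not (==-≢ y≢x))

∖-elim : ∀ {n} (p : Fin n → Bool) x y → (p ∖ x) y ≡ true → p y ≡ true × y ≢ x
∖-elim p x y h = ∧-elimˡ h , not-==⇒≢ (∧-elimʳ (p y) h)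

count-none : ∀ {n} (p : Fin n → Bool) → (∀ i → p i ≡ false) → count p ≡ 0
count-none {zero}  p h = refl
count-none {suc n} p h rewrite h zero = count-none (p ∘ suc) (h ∘ suc)

count-remove : ∀ {n} (p : Fin n → Bool) {x} → p x ≡ true → count p ≡ suc (count (p ∖ x))
count-remove {suc n} p {zero} px rewrite px =
  cong suc (sum-cong-≗ λ i → cong ⟦_⟧ (sym (∧-identityʳ (p (suc i)))))
count-remove {suc n} p {suc x} px
  rewrite count-remove (p ∘ suc) px | ∧-identityʳ (p zero) | +-suc ⟦ p zero ⟧ (count ((p ∘ suc) ∖ x)) =
  cong (λ s → suc (⟦ p zero ⟧ + s)) (sum-cong-≗ λ i → cong (λ b → ⟦ p (suc i) ∧ not b ⟧) (sym (==-suc i x)))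

count-∖ : ∀ {n} (p : Fin n → Bool) {x k} → p x ≡ true → count p ≡ k → count (p ∖ x) ≡ k ∸ 1
count-∖ p px refl = cong (_∸ 1) (sym (count-remove p px))

count-singleton : ∀ {n} (q : Fin n → Bool) (x : Fin n) → count (λ u → (u == x) ∧ q u) ≡ ⟦ q x ⟧
count-singleton {suc n} q zero =
  trans (cong (⟦ q zero ⟧ +_) (count-none {n} _ λ _ → refl)) (+-identityʳ ⟦ q zero ⟧)
count-singleton {suc n} q (suc x) =
  trans (sum-cong-≗ λ i → cong (λ b → ⟦ b ∧ q (suc i) ⟧) (==-suc i x)) (count-singleton (q ∘ suc) x)

count-∨ : ∀ {n} (p q : Fin n → Bool) → (∀ i → p i ∧ q i ≡ false) →
          count (λ i → p i ∨ q i) ≡ count p + count q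
count-∨ p q disjoint =
  trans (sum-cong-≗ λ i → ⟦∨⟧ (p i) (q i) (disjoint i)) (∑-distrib-+ (⟦_⟧ ∘ p) (⟦_⟧ ∘ q))

count-mono : ∀ {n} (p q : Fin n → Bool) → (∀ i → q i ≡ true → p i ≡ true) → count q ≤ count p
count-mono {zero}  p q q⊆p = z≤n
count-mono {suc n} p q q⊆p = +-mono-≤ head (count-mono (p ∘ suc) (q ∘ suc) (q⊆p ∘ suc))
  where
  head : ⟦ q zero ⟧ ≤ ⟦ p zero ⟧
  head with q zero in e
  ... | false = z≤n
  ... | true rewrite q⊆p zero e = ≤-refl

count-mono-< : ∀ {n} (p q : Fin n → Bool) {x} → (∀ i → q i ≡ true → p i ≡ true) →
               p x ≡ true → q x ≡ false → count q < count p
count-mono-< p q {x} q⊆p px qx rewrite count-remove p px = s≤s (count-mono (p ∖ x) q q⊆p∖x)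
  where
  q⊆p∖x : ∀ i → q i ≡ true → (p ∖ x) i ≡ true
  q⊆p∖x i qi with i ≟ x
  ... | yes refl = case trans (sym qi) qx of λ ()
  ... | no _     = trans (∧-identityʳ (p i)) (q⊆p i qi)

∑-guarded-const : ∀ {n} (p : Fin n → Bool) (f : Fin n → ℕ) {c} → (∀ i → p i ≡ true → f i ≡ c) →
                  ∑[ i < n ] (⟦ p i ⟧ * f i) ≡ count p * c
∑-guarded-const p f {c} f≡c = trans (sum-cong-≗ guarded) (sym (*-distribʳ-sum c (⟦_⟧ ∘ p)))
  where
  guarded : ∀ i → ⟦ p i ⟧ * f i ≡ ⟦ p i ⟧ * c
  guarded i with p i in e
  ... | true  = cong (_+ 0) (f≡c i e)
  ... | false = refl

∑-∧-count : ∀ {n} g (p : Fin n → Bool) {k} c → (g ≡ true → count p ≡ k) →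
            ∑[ i < n ] (⟦ g ∧ p i ⟧ * c) ≡ ⟦ g ⟧ * (k * c)
∑-∧-count true  p c count≡k =
  trans (∑-guarded-const p (λ _ → c) (λ _ _ → refl)) (trans (cong (_* c) (count≡k refl)) (sym (+-identityʳ _)))
∑-∧-count {n} false p c _ =
  trans (∑-guarded-const {n} (λ _ → false) (λ _ → c) (λ _ ())) (cong (_* c) (count-none {n} (λ _ → false) (λ _ → refl)))

nested-count : ∀ {n} (p₁ : Fin n → Bool) (p₂ : Fin n → Fin n → Bool)
               (p₃ : Fin n → Fin n → Fin n → Bool) (p₄ : Fin n → Fin n → Fin n → Fin n → Bool) {c₁ c₂ c₃ c₄} →
               count p₁ ≡ c₁ →
               (∀ d → p₁ d ≡ true → count (p₂ d) ≡ c₂) →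
               (∀ d c → p₁ d ∧ p₂ d c ≡ true → count (p₃ d c) ≡ c₃) →
               (∀ d c b → (p₁ d ∧ p₂ d c) ∧ p₃ d c b ≡ true → count (p₄ d c b) ≡ c₄) →
               ∑[ d < n ] ∑[ c < n ] ∑[ b < n ] ∑[ a < n ] ⟦ ((p₁ d ∧ p₂ d c) ∧ p₃ d c b) ∧ p₄ d c b a ⟧
                 ≡ c₁ * (c₂ * (c₃ * (c₄ * 1)))
nested-count {n} p₁ p₂ p₃ p₄ {c₁} {c₂} {c₃} {c₄} h₁ h₂ h₃ h₄ = begin
  ∑[ d < n ] ∑[ c < n ] ∑[ b < n ] ∑[ a < n ] ⟦ ((p₁ d ∧ p₂ d c) ∧ p₃ d c b) ∧ p₄ d c b a ⟧
    ≡⟨ sum-cong-≗ (λ d → sum-cong-≗ λ c → sum-cong-≗ λ b →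
         trans (sum-cong-≗ {n} λ a → sym (*-identityʳ _)) (∑-∧-count ((p₁ d ∧ p₂ d c) ∧ p₃ d c b) (p₄ d c b) 1 (h₄ d c b))) ⟩
  ∑[ d < n ] ∑[ c < n ] ∑[ b < n ] (⟦ (p₁ d ∧ p₂ d c) ∧ p₃ d c b ⟧ * (c₄ * 1))
    ≡⟨ sum-cong-≗ (λ d → sum-cong-≗ λ c → ∑-∧-count (p₁ d ∧ p₂ d c) (p₃ d c) (c₄ * 1) (h₃ d c)) ⟩
  ∑[ d < n ] ∑[ c < n ] (⟦ p₁ d ∧ p₂ d c ⟧ * (c₃ * (c₄ * 1)))
    ≡⟨ sum-cong-≗ (λ d → ∑-∧-count (p₁ d) (p₂ d) (c₃ * (c₄ * 1)) (h₂ d)) ⟩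
  ∑[ d < n ] (⟦ p₁ d ⟧ * (c₂ * (c₃ * (c₄ * 1))))
    ≡⟨ ∑-guarded-const p₁ (λ _ → c₂ * (c₃ * (c₄ * 1))) (λ _ _ → refl) ⟩
  count p₁ * (c₂ * (c₃ * (c₄ * 1)))
    ≡⟨ cong (_* _) h₁ ⟩
  c₁ * (c₂ * (c₃ * (c₄ * 1))) ∎
  where open ≡-Reasoning

module _ {A : Set} where

  all-tabulate⁻ : ∀ {m} (p : A → Bool) (f : Fin m → A) → all p (tabulate f) ≡ true → ∀ i → p (f i) ≡ true
  all-tabulate⁻ p f h zero    = ∧-elimˡ h
  all-tabulate⁻ p f h (suc i) = all-tabulate⁻ p (f ∘ suc) (∧-elimʳ (p (f zero)) h) i

  all-tabulate⁺ : ∀ {m} (p : A → Bool) (f : Fin m → A) → (∀ i → p (f i) ≡ true) → all p (tabulate f) ≡ true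
  all-tabulate⁺ {zero}  p f h = refl
  all-tabulate⁺ {suc m} p f h = cong₂ _∧_ (h zero) (all-tabulate⁺ p (f ∘ suc) (h ∘ suc))

  any-tabulate⁻ : ∀ {m} (p : A → Bool) (f : Fin m → A) → any p (tabulate f) ≡ true → ∃ λ i → p (f i) ≡ true
  any-tabulate⁻ {suc m} p f h with p (f zero) in e
  ... | true  = zero , e
  ... | false with any-tabulate⁻ p (f ∘ suc) h
  ...   | i , pi = suc i , pi

  any-tabulate⁺ : ∀ {m} (p : A → Bool) (f : Fin m → A) i → p (f i) ≡ true → any p (tabulate f) ≡ true
  any-tabulate⁺ p f zero    h rewrite h = refl
  any-tabulate⁺ p f (suc i) h rewrite any-tabulate⁺ p (f ∘ suc) i h = ∨-zeroʳ (p (f zero))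

  all-cong : ∀ (xs : List A) {p q : A → Bool} → (∀ x → p x ≡ q x) → all p xs ≡ all q xs
  all-cong []       p≗q = refl
  all-cong (x ∷ xs) p≗q = cong₂ _∧_ (p≗q x) (all-cong xs p≗q)

  any-cong : ∀ (xs : List A) {p q : A → Bool} → (∀ x → p x ≡ q x) → any p xs ≡ any q xs
  any-cong []       p≗q = refl
  any-cong (x ∷ xs) p≗q = cong₂ _∨_ (p≗q x) (any-cong xs p≗q)

  sumOver : List A → (A → ℕ) → ℕ
  sumOver []       f = 0
  sumOver (x ∷ xs) f = f x + sumOver xs f

  sumOver-cong : ∀ xs {f g : A → ℕ} → (∀ x → f x ≡ g x) → sumOver xs f ≡ sumOver xs g
  sumOver-cong []       f≗g = refl
  sumOver-cong (x ∷ xs) f≗g = cong₂ _+_ (f≗g x) (sumOver-cong xs f≗g)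

  sumOver-const : ∀ (xs : List A) c → sumOver xs (λ _ → c) ≡ length xs * c
  sumOver-const []       c = refl
  sumOver-const (x ∷ xs) c = cong (c +_) (sumOver-const xs c)

  sumOver-++ : ∀ xs ys (f : A → ℕ) → sumOver (xs ++ ys) f ≡ sumOver xs f + sumOver ys f
  sumOver-++ []       ys f = refl
  sumOver-++ (x ∷ xs) ys f = trans (cong (f x +_) (sumOver-++ xs ys f)) (sym (+-assoc (f x) _ _))

  sumOver-tabulate : ∀ {m} (f : Fin m → A) (g : A → ℕ) → sumOver (tabulate f) g ≡ ∑[ i < m ] g (f i)
  sumOver-tabulate {zero}  f g = refl
  sumOver-tabulate {suc m} f g = cong (g (f zero) +_) (sumOver-tabulate (f ∘ suc) g)

  countB≡sumOver : ∀ (p : A → Bool) xs → countB p xs ≡ sumOver xs (⟦_⟧ ∘ p)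
  countB≡sumOver p []       = refl
  countB≡sumOver p (x ∷ xs) with p x
  ... | true  = cong suc (countB≡sumOver p xs)
  ... | false = countB≡sumOver p xs

module _ {A B : Set} where

  sumOver-concatMap : ∀ (g : A → List B) xs (f : B → ℕ) →
                      sumOver (concatMap g xs) f ≡ sumOver xs (λ x → sumOver (g x) f)
  sumOver-concatMap g []       f = refl
  sumOver-concatMap g (x ∷ xs) f =
    trans (sumOver-++ (g x) (concatMap g xs) f) (cong (sumOver (g x) f +_) (sumOver-concatMap g xs f))

  sumOver-map : ∀ (g : A → B) xs (f : B → ℕ) → sumOver (map g xs) f ≡ sumOver xs (f ∘ g)
  sumOver-map g []       f = refl
  sumOver-map g (x ∷ xs) f = cong (f (g x) +_) (sumOver-map g xs f)

countB-allFin : ∀ {n} (p : Fin n → Bool) → countB p (allFin n) ≡ count p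
countB-allFin p = trans (countB≡sumOver p (allFin _)) (sumOver-tabulate (λ i → i) (⟦_⟧ ∘ p))

module _ {n : ℕ} where

  ∑ᵛ : ∀ m → (Vec (Fin n) m → ℕ) → ℕ
  ∑ᵛ zero    f = f []
  ∑ᵛ (suc m) f = ∑ᵛ m (λ v → ∑[ a < n ] f (a ∷ v))

  ∑ᵛ-cong : ∀ m {f g : Vec (Fin n) m → ℕ} → (∀ v → f v ≡ g v) → ∑ᵛ m f ≡ ∑ᵛ m g
  ∑ᵛ-cong zero    f≗g = f≗g []
  ∑ᵛ-cong (suc m) f≗g = ∑ᵛ-cong m λ v → sum-cong-≗ λ a → f≗g (a ∷ v)

  ∑ᵛ-distrib-+ : ∀ m (f g : Vec (Fin n) m → ℕ) → ∑ᵛ m (λ v → f v + g v) ≡ ∑ᵛ m f + ∑ᵛ m g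
  ∑ᵛ-distrib-+ zero    f g = refl
  ∑ᵛ-distrib-+ (suc m) f g =
    trans (∑ᵛ-cong m λ v → ∑-distrib-+ (λ a → f (a ∷ v)) (λ a → g (a ∷ v))) (∑ᵛ-distrib-+ m _ _)

  ∑ᵛ-*ˡ : ∀ m c (f : Vec (Fin n) m → ℕ) → ∑ᵛ m (λ v → c * f v) ≡ c * ∑ᵛ m f
  ∑ᵛ-*ˡ zero    c f = refl
  ∑ᵛ-*ˡ (suc m) c f = trans (∑ᵛ-cong m λ v → sym (*-distribˡ-sum c (λ a → f (a ∷ v)))) (∑ᵛ-*ˡ m c _)

  ∑ᵛ-*ʳ : ∀ m c (f : Vec (Fin n) m → ℕ) → ∑ᵛ m f * c ≡ ∑ᵛ m (λ v → f v * c)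
  ∑ᵛ-*ʳ m c f = trans (*-comm (∑ᵛ m f) c) (trans (sym (∑ᵛ-*ˡ m c f)) (∑ᵛ-cong m λ v → *-comm c (f v)))

  ∑ᵛ-sumOver-comm : ∀ {A : Set} m (xs : List A) (f : Vec (Fin n) m → A → ℕ) →
                    ∑ᵛ m (λ v → sumOver xs (f v)) ≡ sumOver xs (λ x → ∑ᵛ m (λ v → f v x))
  ∑ᵛ-sumOver-comm m []       f = ∑ᵛ-*ˡ m 0 (λ _ → 0)
  ∑ᵛ-sumOver-comm m (x ∷ xs) f =
    trans (∑ᵛ-distrib-+ m (λ v → f v x) (λ v → sumOver xs (f v))) (cong (∑ᵛ m (λ v → f v x) +_) (∑ᵛ-sumOver-comm m xs f))

  sumOver-allMaps : ∀ m (f : Vec (Fin n) m → ℕ) → sumOver (allMaps m n) f ≡ ∑ᵛ m f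
  sumOver-allMaps zero    f = +-identityʳ (f [])
  sumOver-allMaps (suc m) f = begin
    sumOver (allMaps (suc m) n) f
      ≡⟨ sumOver-concatMap (λ v → map (_∷ v) (allFin n)) (allMaps m n) f ⟩
    sumOver (allMaps m n) (λ v → sumOver (map (_∷ v) (allFin n)) f)
      ≡⟨ sumOver-cong (allMaps m n) (λ v → trans (sumOver-map (_∷ v) (allFin n) f) (sumOver-tabulate (λ a → a) (f ∘ (_∷ v)))) ⟩
    sumOver (allMaps m n) (λ v → ∑[ a < n ] f (a ∷ v))
      ≡⟨ sumOver-allMaps m _ ⟩
    ∑ᵛ (suc m) f ∎
    where open ≡-Reasoning

countB-allMaps : ∀ {m n} (p : Vec (Fin n) m → Bool) → countB p (allMaps m n) ≡ ∑ᵛ m (⟦_⟧ ∘ p)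
countB-allMaps {m} p = trans (countB≡sumOver p (allMaps m _)) (sumOver-allMaps m (⟦_⟧ ∘ p))

∑ˢ : ∀ n → (Subset n → ℕ) → ℕ
∑ˢ zero    f = f []
∑ˢ (suc n) f = ∑ˢ n (λ s → f (true ∷ s) + f (false ∷ s))

∑ˢ-cong : ∀ n {f g : Subset n → ℕ} → (∀ X → f X ≡ g X) → ∑ˢ n f ≡ ∑ˢ n g
∑ˢ-cong zero    f≗g = f≗g []
∑ˢ-cong (suc n) f≗g = ∑ˢ-cong n λ s → cong₂ _+_ (f≗g (true ∷ s)) (f≗g (false ∷ s))

sumOver-allSubsets : ∀ n (f : Subset n → ℕ) → sumOver (allSubsets n) f ≡ ∑ˢ n f
sumOver-allSubsets zero    f = +-identityʳ (f [])
sumOver-allSubsets (suc n) f =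
  trans (sumOver-concatMap (λ s → (true ∷ s) ∷ (false ∷ s) ∷ []) (allSubsets n) f)
    (trans (sumOver-cong (allSubsets n) λ s → cong (f (true ∷ s) +_) (+-identityʳ (f (false ∷ s))))
      (sumOver-allSubsets n _))

countB-allSubsets : ∀ n (p : Subset n → Bool) → countB p (allSubsets n) ≡ ∑ˢ n (⟦_⟧ ∘ p)
countB-allSubsets n p = trans (countB≡sumOver p (allSubsets n)) (sumOver-allSubsets n (⟦_⟧ ∘ p))

∑ˢ-*ˡ : ∀ n c (f : Subset n → ℕ) → ∑ˢ n (λ X → c * f X) ≡ c * ∑ˢ n f
∑ˢ-*ˡ zero    c f = refl
∑ˢ-*ˡ (suc n) c f =
  trans (∑ˢ-cong n λ s → sym (*-distribˡ-+ c (f (true ∷ s)) (f (false ∷ s)))) (∑ˢ-*ˡ n c _)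

∑ˢ-∑-comm : ∀ n {m} (f : Subset n → Fin m → ℕ) → ∑ˢ n (λ X → ∑[ i < m ] f X i) ≡ ∑[ i < m ] ∑ˢ n (λ X → f X i)
∑ˢ-∑-comm zero    f = refl
∑ˢ-∑-comm (suc n) f =
  trans (∑ˢ-cong n λ s → sym (∑-distrib-+ (f (true ∷ s)) (f (false ∷ s))))
        (∑ˢ-∑-comm n λ s i → f (true ∷ s) i + f (false ∷ s) i)

∑ˢ-∑ᵛ-comm : ∀ n {k} m (f : Subset n → Vec (Fin k) m → ℕ) →
             ∑ˢ n (λ X → ∑ᵛ m (f X)) ≡ ∑ᵛ m (λ v → ∑ˢ n (λ X → f X v))
∑ˢ-∑ᵛ-comm n zero    f = refl
∑ˢ-∑ᵛ-comm n (suc m) f =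
  trans (∑ˢ-∑ᵛ-comm n m _) (∑ᵛ-cong m λ v → ∑ˢ-∑-comm n λ X a → f X (a ∷ v))

∑ˢ-single : ∀ n (f : Subset n → ℕ) (Y : Subset n) → (∀ X → X ≢ Y → f X ≡ 0) → ∑ˢ n f ≡ f Y
∑ˢ-single zero    f []      _     = refl
∑ˢ-single (suc n) f (b ∷ Y) f≡0 =
  trans (∑ˢ-single n _ Y λ X X≢Y → cong₂ _+_ (f≡0 _ (X≢Y ∘ tail-≡)) (f≡0 _ (X≢Y ∘ tail-≡))) (at b f≡0)
  where
  tail-≡ : ∀ {x y} {X : Subset n} → x ∷ X ≡ y ∷ Y → X ≡ Y
  tail-≡ refl = refl
  at : ∀ b → (∀ X → X ≢ b ∷ Y → f X ≡ 0) → f (true ∷ Y) + f (false ∷ Y) ≡ f (b ∷ Y)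
  at true  f≡0 = trans (cong (f (true ∷ Y) +_) (f≡0 _ λ ())) (+-identityʳ _)
  at false f≡0 = cong (_+ f (false ∷ Y)) (f≡0 _ λ ())

record Pattern : Set where
  constructor mkPattern
  field e01 e02 e03 e12 e13 e23 : Bool
open Pattern

entry : (diagonal : Bool) → Pattern → Fin 4 → Fin 4 → Bool
entry d x 0F 0F = d
entry d x 0F 1F = e01 x
entry d x 0F 2F = e02 x
entry d x 0F 3F = e03 x
entry d x 1F 0F = e01 x
entry d x 1F 1F = d
entry d x 1F 2F = e12 x
entry d x 1F 3F = e13 x
entry d x 2F 0F = e02 x
entry d x 2F 1F = e12 x
entry d x 2F 2F = d
entry d x 2F 3F = e23 x
entry d x 3F 0F = e03 x
entry d x 3F 1F = e13 x
entry d x 3F 2F = e23 x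
entry d x 3F 3F = d

entry-diagonal : ∀ d x i → entry d x i i ≡ d
entry-diagonal d x 0F = refl
entry-diagonal d x 1F = refl
entry-diagonal d x 2F = refl
entry-diagonal d x 3F = refl

edge : Pattern → Fin 4 → Fin 4 → Bool
edge = entry false

complete : Pattern → Bool
complete x = e01 x ∧ e02 x ∧ e03 x ∧ e12 x ∧ e13 x ∧ e23 x

triangleFree : Pattern → Bool
triangleFree (mkPattern x01 x02 x03 x12 x13 x23) =
  not ((x01 ∧ x12 ∧ x02) ∨ (x01 ∧ x13 ∧ x03) ∨ (x02 ∧ x23 ∧ x03) ∨ (x12 ∧ x23 ∧ x13))

every : (Bool → Bool) → Bool
every p = p true ∧ p false

every-sound : ∀ p → every p ≡ true → ∀ b → p b ≡ true
every-sound p h true  = ∧-elimˡ h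
every-sound p h false = ∧-elimʳ (p true) h

everyPattern : (Pattern → Bool) → Bool
everyPattern P = every λ a → every λ b → every λ c → every λ d → every λ e → every λ f → P (mkPattern a b c d e f)

everyPattern-sound : ∀ P → everyPattern P ≡ true → ∀ x → P x ≡ true
everyPattern-sound P h (mkPattern a b c d e f) =
  every-sound (λ f → P (mkPattern a b c d e f))
    (every-sound (λ e → every λ f → P (mkPattern a b c d e f))
      (every-sound (λ d → every λ e → every λ f → P (mkPattern a b c d e f))
        (every-sound (λ c → every λ d → every λ e → every λ f → P (mkPattern a b c d e f))
          (every-sound (λ b → every λ c → every λ d → every λ e → every λ f → P (mkPattern a b c d e f))
            (every-sound (λ a → every λ b → every λ c → every λ d → every λ e → every λ f → P (mkPattern a b c d e f))
              h a) b) c) d) e) f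

∀ᶠ : (Fin 4 → Bool) → Bool
∀ᶠ p = all p (allFin 4)

∀ᶠ-sound : ∀ p → ∀ᶠ p ≡ true → ∀ i → p i ≡ true
∀ᶠ-sound p = all-tabulate⁻ p (λ i → i)

∀ᶠ-complete : ∀ p → (∀ i → p i ≡ true) → ∀ᶠ p ≡ true
∀ᶠ-complete p = all-tabulate⁺ p (λ i → i)

∀ᶠ² : (Fin 4 → Fin 4 → Bool) → Bool
∀ᶠ² q = ∀ᶠ λ i → ∀ᶠ (q i)

∀ᶠ²-sound : ∀ q → ∀ᶠ² q ≡ true → ∀ i j → q i j ≡ true
∀ᶠ²-sound q h i = ∀ᶠ-sound (q i) (∀ᶠ-sound (λ i → ∀ᶠ (q i)) h i)

∀ᶠ³ : (Fin 4 → Fin 4 → Fin 4 → Bool) → Bool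
∀ᶠ³ q = ∀ᶠ λ i → ∀ᶠ² (q i)

∀ᶠ³-sound : ∀ q → ∀ᶠ³ q ≡ true → ∀ i j k → q i j k ≡ true
∀ᶠ³-sound q h i = ∀ᶠ²-sound (q i) (∀ᶠ-sound (λ i → ∀ᶠ² (q i)) h i)

∀ᶠ³-complete : ∀ q → (∀ i j k → q i j k ≡ true) → ∀ᶠ³ q ≡ true
∀ᶠ³-complete q h = ∀ᶠ-complete _ λ i → ∀ᶠ-complete _ λ j → ∀ᶠ-complete (q i j) (h i j)

transitiveᵇ : (Fin 4 → Fin 4 → Bool) → Bool
transitiveᵇ r = ∀ᶠ³ λ i j k → (r i j ∧ r j k) ⇒ᵇ r i k

walkᴾ : Pattern → ℕ → Fin 4 → Fin 4 → Bool
walkᴾ x zero    i j = i == j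
walkᴾ x (suc m) i j = walkᴾ x m i j ∨ any (λ l → walkᴾ x m i l ∧ edge x l j) (allFin 4)

reach : Pattern → Fin 4 → Fin 4 → Bool
reach x = walkᴾ x 3

reachPattern : Pattern → Pattern
reachPattern x = mkPattern (reach x 0F 1F) (reach x 0F 2F) (reach x 0F 3F) (reach x 1F 2F) (reach x 1F 3F) (reach x 2F 3F)

connected : Pattern → Bool
connected x = complete (reachPattern x)

reach-entry : ∀ x i j → reach x i j ≡ entry true (reachPattern x) i j
reach-entry x i j = ⇔ᵇ-sound (∀ᶠ²-sound (agree x) (everyPattern-sound (∀ᶠ² ∘ agree) refl x) i j)
  where
  agree : Pattern → Fin 4 → Fin 4 → Bool
  agree x i j = reach x i j ⇔ᵇ entry true (reachPattern x) i j

reach-refl : ∀ x i → reach x i i ≡ true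
reach-refl x i = trans (reach-entry x i i) (entry-diagonal true (reachPattern x) i)

reach-step : ∀ x i l j → reach x i l ≡ true → edge x l j ≡ true → reach x i j ≡ true
reach-step x i l j ril elj =
  ⇒ᵇ-elim (∀ᶠ³-sound (closed x) (everyPattern-sound (∀ᶠ³ ∘ closed) refl x) i l j) (cong₂ _∧_ ril elj)
  where
  closed : Pattern → Fin 4 → Fin 4 → Fin 4 → Bool
  closed x i l j = (reach x i l ∧ edge x l j) ⇒ᵇ reach x i j

reach-transitive : ∀ x → transitiveᵇ (entry true (reachPattern x)) ≡ true
reach-transitive = everyPattern-sound (λ x → transitiveᵇ (entry true (reachPattern x))) refl

-- A pattern read as a tournament: for i < j the bit ij says that i precedes j.
precedes : Pattern → Fin 4 → Fin 4 → Bool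
precedes o 0F 0F = false
precedes o 0F 1F = e01 o
precedes o 0F 2F = e02 o
precedes o 0F 3F = e03 o
precedes o 1F 0F = not (e01 o)
precedes o 1F 1F = false
precedes o 1F 2F = e12 o
precedes o 1F 3F = e13 o
precedes o 2F 0F = not (e02 o)
precedes o 2F 1F = not (e12 o)
precedes o 2F 2F = false
precedes o 2F 3F = e23 o
precedes o 3F 0F = not (e03 o)
precedes o 3F 1F = not (e13 o)
precedes o 3F 2F = not (e23 o)
precedes o 3F 3F = false

minima : (before related : Fin 4 → Fin 4 → Bool) → ℕ
minima before related = count λ j → not (any (λ i → before i j ∧ related i j) (allFin 4))

-- A linear order has exactly one minimum in each class of an equivalence relation.
minima≡1⇔complete : ∀ o r → transitiveᵇ (precedes o) ≡ true → transitiveᵇ (entry true r) ≡ true →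
                     (minima (precedes o) (entry true r) ≡ᵇ 1) ≡ complete r
minima≡1⇔complete o r o-trans r-trans =
  ⇔ᵇ-sound (⇒ᵇ-elim (everyPattern-sound (check o) (everyPattern-sound (everyPattern ∘ check) refl o) r)
                     (cong₂ _∧_ o-trans r-trans))
  where
  check : Pattern → Pattern → Bool
  check o r = (transitiveᵇ (precedes o) ∧ transitiveᵇ (entry true r)) ⇒ᵇ
              ((minima (precedes o) (entry true r) ≡ᵇ 1) ⇔ᵇ complete r)

K₁₃ : Graph 4
K₁₃ = record
  { adj   = λ u v → not (u == v) ∧ ((u == 3F) ∨ (v == 3F))
  ; sym   = λ u v → cong₂ (λ e c → not e ∧ c) (==-sym u v) (∨-comm (u == 3F) (v == 3F))
  ; irref = λ u → cong (λ e → not e ∧ ((u == 3F) ∨ (u == 3F))) (==-refl u)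
  }

injectiveOn : (e : Fin 4 → Fin 4 → Bool) → Fin 4 → Fin 4 → Bool
injectiveOn e i j = i == j ∨ not (e i j)

homOn : (h e a : Fin 4 → Fin 4 → Bool) → Fin 4 → Fin 4 → Bool
homOn h e a i j = injectiveOn e i j ∧ (not (h i j) ∨ a i j)

homCheck : (h e a : Fin 4 → Fin 4 → Bool) → Bool
homCheck h e a = ∀ᶠ² (homOn h e a)

homCheck-cong : ∀ h {e e′ a a′} → (∀ i j → e i j ≡ e′ i j) → (∀ i j → a i j ≡ a′ i j) →
                homCheck h e a ≡ homCheck h e′ a′
homCheck-cong h e≗e′ a≗a′ = all-cong (allFin 4) λ i → all-cong (allFin 4) λ j →
  cong₂ (λ e a → (i == j ∨ not e) ∧ (not (h i j) ∨ a)) (e≗e′ i j) (a≗a′ i j)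

homCheck-P4 : ∀ x → homCheck (adj P4) _==_ (edge x) ≡ e01 x ∧ (e12 x ∧ e23 x)
homCheck-P4 = ⇔ᵇ-sound ∘ everyPattern-sound (λ x → homCheck (adj P4) _==_ (edge x) ⇔ᵇ (e01 x ∧ (e12 x ∧ e23 x))) refl

homCheck-K₁₃ : ∀ x → homCheck (adj K₁₃) _==_ (edge x) ≡ e03 x ∧ (e13 x ∧ e23 x)
homCheck-K₁₃ = ⇔ᵇ-sound ∘ everyPattern-sound (λ x → homCheck (adj K₁₃) _==_ (edge x) ⇔ᵇ (e03 x ∧ (e13 x ∧ e23 x))) refl

τ : Fin 3 → Fin 4 → Fin 4
τ 0F 0F = 1F
τ 0F 1F = 0F
τ 1F 1F = 2F
τ 1F 2F = 1F
τ 2F 2F = 3F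
τ 2F 3F = 2F
τ _  i  = i

τ-involutive : ∀ s i → τ s (τ s i) ≡ i
τ-involutive 0F 0F = refl
τ-involutive 0F 1F = refl
τ-involutive 0F 2F = refl
τ-involutive 0F 3F = refl
τ-involutive 1F 0F = refl
τ-involutive 1F 1F = refl
τ-involutive 1F 2F = refl
τ-involutive 1F 3F = refl
τ-involutive 2F 0F = refl
τ-involutive 2F 1F = refl
τ-involutive 2F 2F = refl
τ-involutive 2F 3F = refl

σ : List (Fin 3) → Fin 4 → Fin 4
σ []      i = i
σ (s ∷ w) i = σ w (τ s i)

-- The 24 permutations of Fin 4, as words in the adjacent transpositions τ.
permutations : List (List (Fin 3))
permutations =
  [] ∷ (0F ∷ []) ∷ (1F ∷ []) ∷ (2F ∷ []) ∷ (1F ∷ 0F ∷ []) ∷ (2F ∷ 0F ∷ []) ∷ (0F ∷ 1F ∷ []) ∷ (2F ∷ 1F ∷ []) ∷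
  (1F ∷ 2F ∷ []) ∷ (0F ∷ 1F ∷ 0F ∷ []) ∷ (2F ∷ 1F ∷ 0F ∷ []) ∷ (1F ∷ 2F ∷ 0F ∷ []) ∷ (2F ∷ 0F ∷ 1F ∷ []) ∷
  (1F ∷ 2F ∷ 1F ∷ []) ∷ (0F ∷ 1F ∷ 2F ∷ []) ∷ (2F ∷ 0F ∷ 1F ∷ 0F ∷ []) ∷ (1F ∷ 2F ∷ 1F ∷ 0F ∷ []) ∷
  (0F ∷ 1F ∷ 2F ∷ 0F ∷ []) ∷ (1F ∷ 2F ∷ 0F ∷ 1F ∷ []) ∷ (0F ∷ 1F ∷ 2F ∷ 1F ∷ []) ∷ (1F ∷ 2F ∷ 0F ∷ 1F ∷ 0F ∷ []) ∷
  (0F ∷ 1F ∷ 2F ∷ 1F ∷ 0F ∷ []) ∷ (0F ∷ 1F ∷ 2F ∷ 0F ∷ 1F ∷ []) ∷ (0F ∷ 1F ∷ 2F ∷ 0F ∷ 1F ∷ 0F ∷ []) ∷ []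

symmetrised : Graph 4 → Pattern → ℕ
symmetrised H x = sumOver permutations λ w →
  ⟦ homCheck (adj H) (λ i j → σ w i == σ w j) (λ i j → edge x (σ w i) (σ w j)) ⟧

-- A connected triangle-free graph on four vertices is P₄, K₁,₃ or C₄. Over its 24 orderings these
-- admit 2, 0, 8 injective homomorphisms from P₄, 0, 6, 0 from K₁,₃ and 0, 0, 8 from C₄ respectively.
local-identity : ∀ x → triangleFree x ≡ true →
  24 * ⟦ connected x ⟧ + 9 * symmetrised C4 x ≡ 12 * symmetrised P4 x + 4 * symmetrised K₁₃ x
local-identity x tf = ≡ᵇ-sound (⇒ᵇ-elim (everyPattern-sound check refl x) tf)
  where
  check : Pattern → Bool
  check x = triangleFree x ⇒ᵇ
    (24 * ⟦ connected x ⟧ + 9 * symmetrised C4 x ≡ᵇ 12 * symmetrised P4 x + 4 * symmetrised K₁₃ x)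

Tuple : ℕ → Set
Tuple n = Vec (Fin n) 4

Distinct : ∀ {n} → Tuple n → Set
Distinct v = Injective _≡_ _≡_ (lookup v)

∑ᵗ : ∀ {n} → (Tuple n → ℕ) → ℕ
∑ᵗ = ∑ᵛ 4

patternOf : ∀ {n} → Graph n → Tuple n → Pattern
patternOf G (a ∷ b ∷ c ∷ d ∷ []) = mkPattern (adj G a b) (adj G a c) (adj G a d) (adj G b c) (adj G b d) (adj G c d)

adj-pattern : ∀ {n} (G : Graph n) v i j → adj G (lookup v i) (lookup v j) ≡ edge (patternOf G v) i j
adj-pattern G (a ∷ b ∷ c ∷ d ∷ []) 0F 0F = irref G a
adj-pattern G (a ∷ b ∷ c ∷ d ∷ []) 0F 1F = refl
adj-pattern G (a ∷ b ∷ c ∷ d ∷ []) 0F 2F = refl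
adj-pattern G (a ∷ b ∷ c ∷ d ∷ []) 0F 3F = refl
adj-pattern G (a ∷ b ∷ c ∷ d ∷ []) 1F 0F = Graph.sym G b a
adj-pattern G (a ∷ b ∷ c ∷ d ∷ []) 1F 1F = irref G b
adj-pattern G (a ∷ b ∷ c ∷ d ∷ []) 1F 2F = refl
adj-pattern G (a ∷ b ∷ c ∷ d ∷ []) 1F 3F = refl
adj-pattern G (a ∷ b ∷ c ∷ d ∷ []) 2F 0F = Graph.sym G c a
adj-pattern G (a ∷ b ∷ c ∷ d ∷ []) 2F 1F = Graph.sym G c b
adj-pattern G (a ∷ b ∷ c ∷ d ∷ []) 2F 2F = irref G c
adj-pattern G (a ∷ b ∷ c ∷ d ∷ []) 2F 3F = refl
adj-pattern G (a ∷ b ∷ c ∷ d ∷ []) 3F 0F = Graph.sym G d a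
adj-pattern G (a ∷ b ∷ c ∷ d ∷ []) 3F 1F = Graph.sym G d b
adj-pattern G (a ∷ b ∷ c ∷ d ∷ []) 3F 2F = Graph.sym G d c
adj-pattern G (a ∷ b ∷ c ∷ d ∷ []) 3F 3F = irref G d

module _ {n : ℕ} where

  sameAt : Tuple n → Fin 4 → Fin 4 → Bool
  sameAt v i j = lookup v i == lookup v j

  distinct : Tuple n → Bool
  distinct v = ∀ᶠ² (injectiveOn (sameAt v))

  private
    separates : ∀ {i j : Fin 4} {x y : Fin n} → (i == j ∨ not (x == y)) ≡ true → x ≡ y → i ≡ j
    separates {i} {j} {x} h refl =
      ==⇒≡ (trans (sym (∨-identityʳ (i == j))) (subst (λ b → (i == j ∨ not b) ≡ true) (==-refl x) h))

  distinct-sound : ∀ v → distinct v ≡ true → Distinct v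
  distinct-sound v h {i} {j} = separates (∀ᶠ²-sound (injectiveOn (sameAt v)) h i j)

  distinct-complete : ∀ v → Distinct v → distinct v ≡ true
  distinct-complete v inj = ∀ᶠ-complete _ λ i → ∀ᶠ-complete (injectiveOn (sameAt v) i) (separated i)
    where
    separated : ∀ i j → injectiveOn (sameAt v) i j ≡ true
    separated i j with i ≟ j
    ... | yes refl = refl
    ... | no i≢j   = cong not (==-≢ (i≢j ∘ inj))

  distinct-false : ∀ v → distinct v ≡ false → ¬ Distinct v
  distinct-false v dv inj = case trans (sym (distinct-complete v inj)) dv of λ ()

  isInjHom-distinct : ∀ (H : Graph 4) (G : Graph n) v → isInjHom H G v ≡ true → Distinct v
  isInjHom-distinct H G v h {i} {j} =
    separates (∧-elimˡ (∀ᶠ²-sound (homOn (adj H) (sameAt v) (λ i j → adj G (lookup v i) (lookup v j))) h i j))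

  distinct-4 : ∀ {a b c d : Fin n} → a ≢ b → a ≢ c → a ≢ d → b ≢ c → b ≢ d → c ≢ d → Distinct (a ∷ b ∷ c ∷ d ∷ [])
  distinct-4 ab ac ad bc bd cd {0F} {0F} _ = refl
  distinct-4 ab ac ad bc bd cd {0F} {1F} e = ⊥-elim (ab e)
  distinct-4 ab ac ad bc bd cd {0F} {2F} e = ⊥-elim (ac e)
  distinct-4 ab ac ad bc bd cd {0F} {3F} e = ⊥-elim (ad e)
  distinct-4 ab ac ad bc bd cd {1F} {0F} e = ⊥-elim (ab (sym e))
  distinct-4 ab ac ad bc bd cd {1F} {1F} _ = refl
  distinct-4 ab ac ad bc bd cd {1F} {2F} e = ⊥-elim (bc e)
  distinct-4 ab ac ad bc bd cd {1F} {3F} e = ⊥-elim (bd e)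
  distinct-4 ab ac ad bc bd cd {2F} {0F} e = ⊥-elim (ac (sym e))
  distinct-4 ab ac ad bc bd cd {2F} {1F} e = ⊥-elim (bc (sym e))
  distinct-4 ab ac ad bc bd cd {2F} {2F} _ = refl
  distinct-4 ab ac ad bc bd cd {2F} {3F} e = ⊥-elim (cd e)
  distinct-4 ab ac ad bc bd cd {3F} {0F} e = ⊥-elim (ad (sym e))
  distinct-4 ab ac ad bc bd cd {3F} {1F} e = ⊥-elim (bd (sym e))
  distinct-4 ab ac ad bc bd cd {3F} {2F} e = ⊥-elim (cd (sym e))
  distinct-4 ab ac ad bc bd cd {3F} {3F} _ = refl

  distinct-== : ∀ (v : Tuple n) → Distinct v → ∀ i j → lookup v i == lookup v j ≡ i == j
  distinct-== v inj i j with i ≟ j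
  ... | yes refl = ==-refl _
  ... | no i≢j   = ==-≢ (i≢j ∘ inj)

  swap : Fin 3 → Tuple n → Tuple n
  swap s v = Vec.tabulate (lookup v ∘ τ s)

  permute : List (Fin 3) → Tuple n → Tuple n
  permute []      v = v
  permute (s ∷ w) v = swap s (permute w v)

  lookup-permute : ∀ w v i → lookup (permute w v) i ≡ lookup v (σ w i)
  lookup-permute []      v i = refl
  lookup-permute (s ∷ w) v i = trans (lookup∘tabulate (lookup (permute w v) ∘ τ s) i) (lookup-permute w v (τ s i))

  swap-distinct⁻ : ∀ s v → Distinct (swap s v) → Distinct v
  swap-distinct⁻ s v inj {i} {j} e = begin
    i             ≡⟨ τ-involutive s i ⟨
    τ s (τ s i)   ≡⟨ cong (τ s) (inj (trans (unswap i) (trans e (sym (unswap j))))) ⟩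
    τ s (τ s j)   ≡⟨ τ-involutive s j ⟩
    j             ∎
    where
    open ≡-Reasoning
    unswap : ∀ i → lookup (swap s v) (τ s i) ≡ lookup v i
    unswap i = trans (lookup∘tabulate (lookup v ∘ τ s) (τ s i)) (cong (lookup v) (τ-involutive s i))

  permute-distinct⁻ : ∀ w v → Distinct (permute w v) → Distinct v
  permute-distinct⁻ []      v inj = inj
  permute-distinct⁻ (s ∷ w) v inj = permute-distinct⁻ w v (swap-distinct⁻ s (permute w v) inj)

  ∑ᵗ-swap : ∀ s (f : Tuple n → ℕ) → ∑ᵗ (f ∘ swap s) ≡ ∑ᵗ f
  ∑ᵗ-swap 0F f = sum-cong-≗ λ d → sum-cong-≗ λ c → ∑-comm λ b a → f (b ∷ a ∷ c ∷ d ∷ [])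
  ∑ᵗ-swap 1F f = sum-cong-≗ λ d → ∑-comm λ c b → ∑[ a < n ] f (a ∷ c ∷ b ∷ d ∷ [])
  ∑ᵗ-swap 2F f = ∑-comm λ d c → ∑[ b < n ] ∑[ a < n ] f (a ∷ b ∷ d ∷ c ∷ [])

  ∑ᵗ-permute : ∀ w (f : Tuple n → ℕ) → ∑ᵗ (f ∘ permute w) ≡ ∑ᵗ f
  ∑ᵗ-permute []      f = refl
  ∑ᵗ-permute (s ∷ w) f = trans (∑ᵗ-permute w (f ∘ swap s)) (∑ᵗ-swap s f)

  ∑ᵗ-symmetrise : ∀ (f : Tuple n → ℕ) → ∑ᵗ (λ v → sumOver permutations λ w → f (permute w v)) ≡ 24 * ∑ᵗ f
  ∑ᵗ-symmetrise f = begin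
    ∑ᵗ (λ v → sumOver permutations λ w → f (permute w v))   ≡⟨ ∑ᵛ-sumOver-comm 4 permutations (λ v w → f (permute w v)) ⟩
    sumOver permutations (λ w → ∑ᵗ (f ∘ permute w))          ≡⟨ sumOver-cong permutations (λ w → ∑ᵗ-permute w f) ⟩
    sumOver permutations (λ _ → ∑ᵗ f)                        ≡⟨ sumOver-const permutations (∑ᵗ f) ⟩
    24 * ∑ᵗ f                                                ∎
    where open ≡-Reasoning

module _ {n} (G : Graph n) where

  isInjHom-permute : ∀ (H : Graph 4) v → Distinct v → ∀ w →
    isInjHom H G (permute w v) ≡
    homCheck (adj H) (λ i j → σ w i == σ w j) (λ i j → edge (patternOf G v) (σ w i) (σ w j))
  isInjHom-permute H v inj w = homCheck-cong (adj H)
    (λ i j → trans (cong₂ _==_ (lookup-permute w v i) (lookup-permute w v j)) (distinct-== v inj (σ w i) (σ w j)))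
    (λ i j → trans (cong₂ (adj G) (lookup-permute w v i) (lookup-permute w v j)) (adj-pattern G v (σ w i) (σ w j)))

  symmetrisedAt : Graph 4 → Tuple n → ℕ
  symmetrisedAt H v = sumOver permutations λ w → ⟦ isInjHom H G (permute w v) ⟧

  symmetrisedAt-distinct : ∀ H v → Distinct v → symmetrisedAt H v ≡ symmetrised H (patternOf G v)
  symmetrisedAt-distinct H v inj = sumOver-cong permutations λ w → cong ⟦_⟧ (isInjHom-permute H v inj w)

  symmetrisedAt-nondistinct : ∀ H v → ¬ Distinct v → symmetrisedAt H v ≡ 0
  symmetrisedAt-nondistinct H v ¬inj = trans (sumOver-cong permutations vanishes) (sumOver-const permutations 0)
    where
    vanishes : ∀ w → ⟦ isInjHom H G (permute w v) ⟧ ≡ 0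
    vanishes w with isInjHom H G (permute w v) in hom
    ... | false = refl
    ... | true  = ⊥-elim (¬inj (permute-distinct⁻ w v (isInjHom-distinct H G (permute w v) hom)))

  ∑ᵗ-symmetrisedAt : ∀ H → ∑ᵗ (symmetrisedAt H) ≡ 24 * injHom H G
  ∑ᵗ-symmetrisedAt H =
    trans (∑ᵗ-symmetrise (⟦_⟧ ∘ isInjHom H G)) (cong (24 *_) (sym (countB-allMaps (isInjHom H G))))

module _ {n : ℕ} where

  _∈ᵇ_ : ∀ {m} → Fin n → Vec (Fin n) m → Bool
  u ∈ᵇ []      = false
  u ∈ᵇ (a ∷ v) = u == a ∨ u ∈ᵇ v

  lookup-∈ᵇ : ∀ {m} (v : Vec (Fin n) m) i → lookup v i ∈ᵇ v ≡ true
  lookup-∈ᵇ (a ∷ v) zero    = cong (_∨ a ∈ᵇ v) (==-refl a)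
  lookup-∈ᵇ (a ∷ v) (suc i) = trans (cong (lookup v i == a ∨_) (lookup-∈ᵇ v i)) (∨-zeroʳ _)

  ∈ᵇ-lookup : ∀ {m} (v : Vec (Fin n) m) {u} → u ∈ᵇ v ≡ true → ∃ λ i → u ≡ lookup v i
  ∈ᵇ-lookup (a ∷ v) {u} h with u == a in ua
  ... | true  = zero , ==⇒≡ ua
  ... | false with ∈ᵇ-lookup v h
  ...   | i , u≡vi = suc i , u≡vi

  any-∈ᵇ : ∀ {m} (v : Vec (Fin n) m) (r : Fin n → Bool) → (∀ w → r w ≡ true → w ∈ᵇ v ≡ true) →
           any r (allFin n) ≡ any (r ∘ lookup v) (allFin m)
  any-∈ᵇ v r r⊆v = ⇔→≡ {z = true} (mk⇔ to from)
    where
    to : any r (allFin n) ≡ true → any (r ∘ lookup v) (allFin _) ≡ true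
    to h with any-tabulate⁻ r (λ w → w) h
    ... | w , rw with ∈ᵇ-lookup v (r⊆v w rw)
    ...   | i , refl = any-tabulate⁺ (r ∘ lookup v) (λ i → i) i rw
    from : any (r ∘ lookup v) (allFin _) ≡ true → any r (allFin n) ≡ true
    from h with any-tabulate⁻ (r ∘ lookup v) (λ i → i) h
    ... | i , rvi = any-tabulate⁺ r (λ w → w) (lookup v i) rvi

  count-∈ᵇ : ∀ {m} (v : Vec (Fin n) m) → Injective _≡_ _≡_ (lookup v) → ∀ (q : Fin n → Bool) →
             count (λ u → u ∈ᵇ v ∧ q u) ≡ ∑[ i < m ] ⟦ q (lookup v i) ⟧
  count-∈ᵇ []      inj q = count-none (λ u → false ∧ q u) (λ _ → refl)
  count-∈ᵇ {suc m} (a ∷ v) inj q = begin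
    count (λ u → (u == a ∨ u ∈ᵇ v) ∧ q u)
      ≡⟨ sum-cong-≗ (λ u → cong ⟦_⟧ (∧-distribʳ-∨ (q u) (u == a) (u ∈ᵇ v))) ⟩
    count (λ u → (u == a ∧ q u) ∨ (u ∈ᵇ v ∧ q u))
      ≡⟨ count-∨ (λ u → u == a ∧ q u) (λ u → u ∈ᵇ v ∧ q u) disjoint ⟩
    count (λ u → u == a ∧ q u) + count (λ u → u ∈ᵇ v ∧ q u)
      ≡⟨ cong₂ _+_ (count-singleton q a) (count-∈ᵇ v (Fin.suc-injective ∘ inj) q) ⟩
    ⟦ q a ⟧ + ∑[ i < m ] ⟦ q (lookup v i) ⟧ ∎
    where
    open ≡-Reasoning
    disjoint : ∀ u → (u == a ∧ q u) ∧ (u ∈ᵇ v ∧ q u) ≡ false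
    disjoint u with u == a in ua | u ∈ᵇ v in uv
    ... | false | _     = refl
    ... | true  | false = ∧-zeroʳ (q u)
    ... | true  | true with ∈ᵇ-lookup v uv
    ...   | i , u≡vi with inj {zero} {suc i} (trans (sym (==⇒≡ ua)) u≡vi)
    ...     | ()

tupleSet : ∀ {n} → Tuple n → Subset n
tupleSet v = Vec.tabulate (_∈ᵇ v)

tupleSet-∈ᵇ : ∀ {n} (v : Tuple n) u → lookup (tupleSet v) u ≡ u ∈ᵇ v
tupleSet-∈ᵇ v = lookup∘tabulate (_∈ᵇ v)

tupleSet-has : ∀ {n} (v : Tuple n) i → lookup (tupleSet v) (lookup v i) ≡ true
tupleSet-has v i = trans (tupleSet-∈ᵇ v (lookup v i)) (lookup-∈ᵇ v i)

count-∈ᵇ-4 : ∀ {n} (v : Tuple n) → Distinct v → count (_∈ᵇ v) ≡ 4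
count-∈ᵇ-4 v inj = trans (sum-cong-≗ λ u → cong ⟦_⟧ (sym (∧-identityʳ (u ∈ᵇ v)))) (count-∈ᵇ v inj (λ _ → true))

size-tupleSet : ∀ {n} (v : Tuple n) → Distinct v → size (tupleSet v) ≡ 4
size-tupleSet v inj =
  trans (countB-allFin (lookup (tupleSet v))) (trans (sum-cong-≗ (cong ⟦_⟧ ∘ tupleSet-∈ᵇ v)) (count-∈ᵇ-4 v inj))

key : ∀ {n} → Tuple n → Fin 4 → ℕ
key v i = toℕ (lookup v i)

orderPattern : ∀ {n} → Tuple n → Pattern
orderPattern v = mkPattern (key v 0F <ᵇ key v 1F) (key v 0F <ᵇ key v 2F) (key v 0F <ᵇ key v 3F)
                           (key v 1F <ᵇ key v 2F) (key v 1F <ᵇ key v 3F) (key v 2F <ᵇ key v 3F)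

key-flip : ∀ {n} (v : Tuple n) → Distinct v → ∀ i j → i ≢ j → (key v j <ᵇ key v i) ≡ not (key v i <ᵇ key v j)
key-flip v inj i j i≢j = <ᵇ-flip (λ e → i≢j (inj (toℕ-injective e)))

precedes-order : ∀ {n} (v : Tuple n) → Distinct v → ∀ i j → precedes (orderPattern v) i j ≡ (key v i <ᵇ key v j)
precedes-order v inj 0F 0F = sym (<ᵇ-irrefl (key v 0F))
precedes-order v inj 0F 1F = refl
precedes-order v inj 0F 2F = refl
precedes-order v inj 0F 3F = refl
precedes-order v inj 1F 0F = sym (key-flip v inj 0F 1F λ ())
precedes-order v inj 1F 1F = sym (<ᵇ-irrefl (key v 1F))
precedes-order v inj 1F 2F = refl
precedes-order v inj 1F 3F = refl
precedes-order v inj 2F 0F = sym (key-flip v inj 0F 2F λ ())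
precedes-order v inj 2F 1F = sym (key-flip v inj 1F 2F λ ())
precedes-order v inj 2F 2F = sym (<ᵇ-irrefl (key v 2F))
precedes-order v inj 2F 3F = refl
precedes-order v inj 3F 0F = sym (key-flip v inj 0F 3F λ ())
precedes-order v inj 3F 1F = sym (key-flip v inj 1F 3F λ ())
precedes-order v inj 3F 2F = sym (key-flip v inj 2F 3F λ ())
precedes-order v inj 3F 3F = sym (<ᵇ-irrefl (key v 3F))

precedes-transitive : ∀ {n} (v : Tuple n) → Distinct v → transitiveᵇ (precedes (orderPattern v)) ≡ true
precedes-transitive v inj = ∀ᶠ³-complete _ λ i j k → ⇒ᵇ-intro λ h →
  trans (precedes-order v inj i k)
    (<ᵇ-trans (key v i) (key v j) (key v k)
      (trans (sym (precedes-order v inj i j)) (∧-elimˡ h))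
      (trans (sym (precedes-order v inj j k)) (∧-elimʳ (precedes (orderPattern v) i j) h)))

module _ {n} (G : Graph n) where

  isConnected : Subset n → Bool
  isConnected X = components G X ≡ᵇ 1

  walk-start : ∀ X m u w → walkIn G X m u w ≡ true → lookup X u ≡ true
  walk-start X zero    u w h = ∧-elimʳ (u == w) h
  walk-start X (suc m) u w h with walkIn G X m u w in e
  ... | true  = walk-start X m u w e
  ... | false with any-tabulate⁻ (λ w′ → walkIn G X m u w′ ∧ lookup X w ∧ adj G w′ w) (λ w′ → w′) h
  ...   | w′ , step = walk-start X m u w′ (∧-elimˡ step)

  walk-mono : ∀ X m k u w → walkIn G X m u w ≡ true → walkIn G X (k + m) u w ≡ true
  walk-mono X m zero    u w h = h
  walk-mono X m (suc k) u w h rewrite walk-mono X m k u w h = refl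

  module _ (v : Tuple n) (inj : Distinct v) where

    private
      X : Subset n
      X = tupleSet v
      x : Pattern
      x = patternOf G v
      t : Fin 4 → Fin n
      t = lookup v

      X⇒∈ᵇ : ∀ w → lookup X w ≡ true → w ∈ᵇ v ≡ true
      X⇒∈ᵇ w h = trans (sym (tupleSet-∈ᵇ v w)) h

    walk-projects : ∀ m i w → walkIn G X m (t i) w ≡ true → ∃ λ j → w ≡ t j × reach x i j ≡ true
    walk-projects zero    i w h = i , sym (==⇒≡ (∧-elimˡ h)) , reach-refl x i
    walk-projects (suc m) i w h with walkIn G X m (t i) w in e
    ... | true  = walk-projects m i w e
    ... | false with any-tabulate⁻ (λ w′ → walkIn G X m (t i) w′ ∧ lookup X w ∧ adj G w′ w) (λ w′ → w′) h
    ...   | w′ , step with walk-projects m i w′ (∧-elimˡ step)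
                         | ∈ᵇ-lookup v (X⇒∈ᵇ w (∧-elimˡ (∧-elimʳ (walkIn G X m (t i) w′) step)))
    ...     | l , refl , ril | j , refl =
      j , refl , reach-step x i l j ril
                   (trans (sym (adj-pattern G v l j)) (∧-elimʳ (lookup X w) (∧-elimʳ (walkIn G X m (t i) w′) step)))

    walk-lifts : ∀ m i j → walkᴾ x m i j ≡ true → walkIn G X m (t i) (t j) ≡ true
    walk-lifts zero    i j h with ==⇒≡ h
    ... | refl = cong₂ _∧_ (==-refl (t i)) (tupleSet-has v i)
    walk-lifts (suc m) i j h with walkᴾ x m i j in e
    ... | true  = cong (_∨ any (λ w → walkIn G X m (t i) w ∧ lookup X (t j) ∧ adj G w (t j)) (allFin n))
                       (walk-lifts m i j e)
    ... | false with any-tabulate⁻ (λ l → walkᴾ x m i l ∧ edge x l j) (λ l → l) h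
    ...   | l , step =
      trans (cong (walkIn G X m (t i) (t j) ∨_)
                  (any-tabulate⁺ (λ w → walkIn G X m (t i) w ∧ lookup X (t j) ∧ adj G w (t j)) (λ w → w) (t l) extend))
            (∨-zeroʳ (walkIn G X m (t i) (t j)))
      where
      extend : walkIn G X m (t i) (t l) ∧ lookup X (t j) ∧ adj G (t l) (t j) ≡ true
      extend = cong₂ _∧_ (walk-lifts m i l (∧-elimˡ step))
                         (cong₂ _∧_ (tupleSet-has v j) (trans (adj-pattern G v l j) (∧-elimʳ (walkᴾ x m i l) step)))

    -- reach only looks at walks of length at most 3, which fit into the n ≥ 4 steps allowed by connIn.
    connIn-reach : ∀ i j → connIn G X (t i) (t j) ≡ reach x i j
    connIn-reach i j = ⇔→≡ {z = true} (mk⇔ to from)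
      where
      to : connIn G X (t i) (t j) ≡ true → reach x i j ≡ true
      to h with walk-projects n i (t j) h
      ... | j′ , tj≡tj′ , r rewrite inj tj≡tj′ = r
      from : reach x i j ≡ true → connIn G X (t i) (t j) ≡ true
      from h = subst (λ m → walkIn G X m (t i) (t j) ≡ true) (m∸n+n≡m (<⇒≤ (injective⇒≤ inj)))
                     (walk-mono X 3 (n ∸ 3) (t i) (t j) (walk-lifts 3 i j h))

    private
      leastIn : Fin n → Bool
      leastIn u = not (any (λ w → (toℕ w <ᵇ toℕ u) ∧ connIn G X w u) (allFin n))

      leastIn-pattern : ∀ j → leastIn (t j) ≡
                        not (any (λ i → precedes (orderPattern v) i j ∧ entry true (reachPattern x) i j) (allFin 4))
      leastIn-pattern j = cong not (trans
        (any-∈ᵇ v _ λ w h → X⇒∈ᵇ w (walk-start X n w (t j) (∧-elimʳ (toℕ w <ᵇ toℕ (t j)) h)))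
        (any-cong (allFin 4) λ i →
          cong₂ _∧_ (sym (precedes-order v inj i j)) (trans (connIn-reach i j) (reach-entry x i j))))

    components-tupleSet : components G X ≡ minima (precedes (orderPattern v)) (entry true (reachPattern x))
    components-tupleSet = begin
      components G X                         ≡⟨ countB-allFin (λ u → lookup X u ∧ leastIn u) ⟩
      count (λ u → lookup X u ∧ leastIn u)   ≡⟨ sum-cong-≗ (λ u → cong (λ b → ⟦ b ∧ leastIn u ⟧) (tupleSet-∈ᵇ v u)) ⟩
      count (λ u → u ∈ᵇ v ∧ leastIn u)       ≡⟨ count-∈ᵇ v inj leastIn ⟩
      ∑[ j < 4 ] ⟦ leastIn (t j) ⟧           ≡⟨ sum-cong-≗ (cong ⟦_⟧ ∘ leastIn-pattern) ⟩
      minima (precedes (orderPattern v)) (entry true (reachPattern x)) ∎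
      where open ≡-Reasoning

    isConnected-tupleSet : isConnected X ≡ connected x
    isConnected-tupleSet = trans (cong (_≡ᵇ 1) components-tupleSet)
      (minima≡1⇔complete (orderPattern v) (reachPattern x) (precedes-transitive v inj) (reach-transitive x))

-- The tuple lists distinct elements of X, in the nested form evaluated by nested-count.
tupleIn : ∀ {n} → Subset n → Tuple n → Bool
tupleIn X (a ∷ b ∷ c ∷ d ∷ []) = ((m d ∧ (m ∖ d) c) ∧ ((m ∖ d) ∖ c) b) ∧ (((m ∖ d) ∖ c) ∖ b) a
  where
  m : Fin _ → Bool
  m = lookup X

∑ᵗ-tupleIn-size4 : ∀ {n} (X : Subset n) → size X ≡ 4 → ∑ᵗ (λ v → ⟦ tupleIn X v ⟧) ≡ 24
∑ᵗ-tupleIn-size4 X size≡4 = nested-count m (m ∖_) (λ d c → (m ∖ d) ∖ c) (λ d c b → ((m ∖ d) ∖ c) ∖ b)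
  count-m
  (λ d md → count-∖ m md count-m)
  (λ d c h → count-∖ (m ∖ d) (∧-elimʳ (m d) h) (count-∖ m (∧-elimˡ h) count-m))
  (λ d c b h → count-∖ ((m ∖ d) ∖ c) (∧-elimʳ (m d ∧ (m ∖ d) c) h)
                 (count-∖ (m ∖ d) (∧-elimʳ (m d) (∧-elimˡ h)) (count-∖ m (∧-elimˡ (∧-elimˡ h)) count-m)))
  where
  m : Fin _ → Bool
  m = lookup X
  count-m : count m ≡ 4
  count-m = trans (sym (countB-allFin m)) size≡4

module _ {n} (X : Subset n) (a b c d : Fin n) where

  private
    m : Fin n → Bool
    m = lookup X

  tupleIn-sound : tupleIn X (a ∷ b ∷ c ∷ d ∷ []) ≡ true →
                  Distinct (a ∷ b ∷ c ∷ d ∷ []) × (∀ i → m (lookup (a ∷ b ∷ c ∷ d ∷ []) i) ≡ true)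
  tupleIn-sound h
    with ∧-elimˡ {m d ∧ (m ∖ d) c} (∧-elimˡ h)
       | ∖-elim m d c (∧-elimʳ (m d) (∧-elimˡ (∧-elimˡ h)))
       | ∖-elim (m ∖ d) c b (∧-elimʳ (m d ∧ (m ∖ d) c) (∧-elimˡ h))
       | ∖-elim ((m ∖ d) ∖ c) b a (∧-elimʳ ((m d ∧ (m ∖ d) c) ∧ ((m ∖ d) ∖ c) b) h)
  ... | md∧mc | mc , c≢d | m∖d-b , b≢c | m∖d∖c-a , a≢b
    with ∖-elim m d b m∖d-b | ∖-elim (m ∖ d) c a m∖d∖c-a
  ... | mb , b≢d | m∖d-a , a≢c
    with ∖-elim m d a m∖d-a
  ... | ma , a≢d = distinct-4 a≢b a≢c a≢d b≢c b≢d c≢d , members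
    where
    members : ∀ i → m (lookup (a ∷ b ∷ c ∷ d ∷ []) i) ≡ true
    members 0F = ma
    members 1F = mb
    members 2F = mc
    members 3F = ∧-elimˡ md∧mc

  tupleIn-complete : Distinct (a ∷ b ∷ c ∷ d ∷ []) → (∀ i → m (lookup (a ∷ b ∷ c ∷ d ∷ []) i) ≡ true) →
                     tupleIn X (a ∷ b ∷ c ∷ d ∷ []) ≡ true
  tupleIn-complete inj mem =
    cong₂ _∧_ (cong₂ _∧_ (cong₂ _∧_ (mem 3F) (∖-intro m (mem 2F) (apart 2F 3F λ ())))
                         (∖-intro (m ∖ d) (∖-intro m (mem 1F) (apart 1F 3F λ ())) (apart 1F 2F λ ())))
              (∖-intro ((m ∖ d) ∖ c) (∖-intro (m ∖ d) (∖-intro m (mem 0F) (apart 0F 3F λ ())) (apart 0F 2F λ ()))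
                       (apart 0F 1F λ ()))
    where
    apart : ∀ i j → i ≢ j → lookup (a ∷ b ∷ c ∷ d ∷ []) i ≢ lookup (a ∷ b ∷ c ∷ d ∷ []) j
    apart i j i≢j = i≢j ∘ inj

tupleIn-tupleSet : ∀ {n} (v : Tuple n) → tupleIn (tupleSet v) v ≡ distinct v
tupleIn-tupleSet v@(a ∷ b ∷ c ∷ d ∷ []) = ⇔→≡ {z = true} (mk⇔ to from)
  where
  to : tupleIn (tupleSet v) v ≡ true → distinct v ≡ true
  to h = distinct-complete v (proj₁ (tupleIn-sound (tupleSet v) a b c d h))
  from : distinct v ≡ true → tupleIn (tupleSet v) v ≡ true
  from h = tupleIn-complete (tupleSet v) a b c d (distinct-sound v h) (tupleSet-has v)

tupleIn-size4⇒tupleSet : ∀ {n} (X : Subset n) (v : Tuple n) → tupleIn X v ≡ true → size X ≡ 4 → X ≡ tupleSet v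
tupleIn-size4⇒tupleSet X v@(a ∷ b ∷ c ∷ d ∷ []) h size≡4 = trans (sym (tabulate∘lookup X)) (tabulate-cong same)
  where
  inj : Distinct v
  inj = proj₁ (tupleIn-sound X a b c d h)
  members : ∀ u → u ∈ᵇ v ≡ true → lookup X u ≡ true
  members u u∈v with ∈ᵇ-lookup v {u} u∈v
  ... | i , refl = proj₂ (tupleIn-sound X a b c d h) i
  same : ∀ u → lookup X u ≡ u ∈ᵇ v
  same u with u ∈ᵇ v in u∈v
  ... | true  = members u u∈v
  ... | false with lookup X u in Xu
  ...   | false = refl
  ...   | true  = ⊥-elim (<-irrefl refl (subst₂ _<_ (count-∈ᵇ-4 v inj) (trans (sym (countB-allFin (lookup X))) size≡4)
                            (count-mono-< (lookup X) (_∈ᵇ v) members Xu u∈v)))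

module _ {n} (G : Graph n) where

  private
    weight : Subset n → ℕ
    weight X = ⟦ (size X ≡ᵇ 4) ∧ isConnected G X ⟧

    count-tuplesIn : ∀ X → 24 * weight X ≡ ∑ᵗ (λ v → ⟦ tupleIn X v ⟧ * weight X)
    count-tuplesIn X = trans (scaled X) (∑ᵛ-*ʳ 4 (weight X) (λ v → ⟦ tupleIn X v ⟧))
      where
      scaled : ∀ X → 24 * ⟦ (size X ≡ᵇ 4) ∧ isConnected G X ⟧ ≡
                     ∑ᵗ (λ v → ⟦ tupleIn X v ⟧) * ⟦ (size X ≡ᵇ 4) ∧ isConnected G X ⟧
      scaled X with size X ≡ᵇ 4 in size4
      ... | true  = cong (_* ⟦ isConnected G X ⟧) (sym (∑ᵗ-tupleIn-size4 X (≡ᵇ-sound size4)))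
      ... | false = sym (*-zeroʳ (∑ᵗ (λ v → ⟦ tupleIn X v ⟧)))

    only-tupleSet : ∀ v → ∑ˢ n (λ X → ⟦ tupleIn X v ⟧ * weight X) ≡ ⟦ distinct v ∧ isConnected G (tupleSet v) ⟧
    only-tupleSet v = trans (∑ˢ-single n _ (tupleSet v) vanishes) at-tupleSet
      where
      vanishes : ∀ X → X ≢ tupleSet v → ⟦ tupleIn X v ⟧ * ⟦ (size X ≡ᵇ 4) ∧ isConnected G X ⟧ ≡ 0
      vanishes X X≢ with tupleIn X v in inX | size X ≡ᵇ 4 in size4
      ... | false | _     = refl
      ... | true  | false = refl
      ... | true  | true  = ⊥-elim (X≢ (tupleIn-size4⇒tupleSet X v inX (≡ᵇ-sound size4)))
      at-tupleSet : ⟦ tupleIn (tupleSet v) v ⟧ * weight (tupleSet v) ≡ ⟦ distinct v ∧ isConnected G (tupleSet v) ⟧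
      at-tupleSet rewrite tupleIn-tupleSet v with distinct v in dv
      ... | false = refl
      ... | true rewrite size-tupleSet v (distinct-sound v dv) = +-identityʳ _

  Qcoeff-double-count : 24 * Qcoeff G 4 1 ≡ ∑ᵗ (λ v → ⟦ distinct v ∧ isConnected G (tupleSet v) ⟧)
  Qcoeff-double-count = begin
    24 * Qcoeff G 4 1                                       ≡⟨ cong (24 *_) (countB-allSubsets n _) ⟩
    24 * ∑ˢ n weight                                         ≡⟨ ∑ˢ-*ˡ n 24 weight ⟨
    ∑ˢ n (λ X → 24 * weight X)                               ≡⟨ ∑ˢ-cong n count-tuplesIn ⟩
    ∑ˢ n (λ X → ∑ᵗ (λ v → ⟦ tupleIn X v ⟧ * weight X))       ≡⟨ ∑ˢ-∑ᵛ-comm n 4 (λ X v → ⟦ tupleIn X v ⟧ * weight X) ⟩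
    ∑ᵗ (λ v → ∑ˢ n (λ X → ⟦ tupleIn X v ⟧ * weight X))       ≡⟨ ∑ᵛ-cong 4 only-tupleSet ⟩
    ∑ᵗ (λ v → ⟦ distinct v ∧ isConnected G (tupleSet v) ⟧)   ∎
    where open ≡-Reasoning

TriangleFree : ∀ {n} → Graph n → Set
TriangleFree G = ∀ a b c → adj G a b ≡ true → adj G b c ≡ true → adj G a c ≡ true → ⊥

bipartite⇒triangleFree : ∀ {n} (G : Graph n) → Bipartite G → TriangleFree G
bipartite⇒triangleFree G (colour , proper) a b c ab bc ac =
  proper a c ac (trans (¬-not (proper a b ab)) (sym (¬-not (≢-sym (proper b c bc)))))

module _ {n} (G : Graph n) (triangle-free : TriangleFree G) where

  private
    no-triangle : ∀ a b c → adj G a b ∧ adj G b c ∧ adj G a c ≡ false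
    no-triangle a b c with adj G a b in ab | adj G b c in bc | adj G a c in ac
    ... | false | _     | _     = refl
    ... | true  | false | _     = refl
    ... | true  | true  | false = refl
    ... | true  | true  | true  = ⊥-elim (triangle-free a b c ab bc ac)

    pattern-triangleFree : ∀ v → triangleFree (patternOf G v) ≡ true
    pattern-triangleFree (a ∷ b ∷ c ∷ d ∷ []) =
      cong not (cong₂ _∨_ (no-triangle a b c) (cong₂ _∨_ (no-triangle a b d) (cong₂ _∨_ (no-triangle a c d) (no-triangle b c d))))

  local-identity-at : ∀ v →
    24 * ⟦ distinct v ∧ isConnected G (tupleSet v) ⟧ + 9 * symmetrisedAt G C4 v
      ≡ 12 * symmetrisedAt G P4 v + 4 * symmetrisedAt G K₁₃ v
  local-identity-at v = by-distinctness (distinct v) refl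
    where
    by-distinctness : ∀ b → distinct v ≡ b →
      24 * ⟦ b ∧ isConnected G (tupleSet v) ⟧ + 9 * symmetrisedAt G C4 v
        ≡ 12 * symmetrisedAt G P4 v + 4 * symmetrisedAt G K₁₃ v
    by-distinctness false dv =
      trans (cong (9 *_) (vanishes C4)) (sym (cong₂ (λ p s → 12 * p + 4 * s) (vanishes P4) (vanishes K₁₃)))
      where
      vanishes : ∀ H → symmetrisedAt G H v ≡ 0
      vanishes H = symmetrisedAt-nondistinct G H v (distinct-false v dv)
    by-distinctness true dv = begin
      24 * ⟦ isConnected G (tupleSet v) ⟧ + 9 * symmetrisedAt G C4 v
        ≡⟨ cong₂ (λ c s → 24 * ⟦ c ⟧ + 9 * s) (isConnected-tupleSet G v inj) (symmetrisedAt-distinct G C4 v inj) ⟩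
      24 * ⟦ connected (patternOf G v) ⟧ + 9 * symmetrised C4 (patternOf G v)
        ≡⟨ local-identity (patternOf G v) (pattern-triangleFree v) ⟩
      12 * symmetrised P4 (patternOf G v) + 4 * symmetrised K₁₃ (patternOf G v)
        ≡⟨ cong₂ (λ p s → 12 * p + 4 * s) (symmetrisedAt-distinct G P4 v inj) (symmetrisedAt-distinct G K₁₃ v inj) ⟨
      12 * symmetrisedAt G P4 v + 4 * symmetrisedAt G K₁₃ v ∎
      where
      open ≡-Reasoning
      inj : Distinct v
      inj = distinct-sound v dv

  subgraph-identity :
    24 * (24 * Qcoeff G 4 1) + 9 * (24 * injHom C4 G) ≡ 12 * (24 * injHom P4 G) + 4 * (24 * injHom K₁₃ G)
  subgraph-identity = begin
    24 * (24 * Qcoeff G 4 1) + 9 * (24 * injHom C4 G)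
      ≡⟨ cong₂ (λ q c → 24 * q + 9 * c) (Qcoeff-double-count G) (sym (∑ᵗ-symmetrisedAt G C4)) ⟩
    24 * ∑ᵗ connected4 + 9 * ∑ᵗ (symmetrisedAt G C4)
      ≡⟨ ∑ᵗ-linear 24 9 connected4 (symmetrisedAt G C4) ⟨
    ∑ᵗ (λ v → 24 * connected4 v + 9 * symmetrisedAt G C4 v)
      ≡⟨ ∑ᵛ-cong 4 local-identity-at ⟩
    ∑ᵗ (λ v → 12 * symmetrisedAt G P4 v + 4 * symmetrisedAt G K₁₃ v)
      ≡⟨ ∑ᵗ-linear 12 4 (symmetrisedAt G P4) (symmetrisedAt G K₁₃) ⟩
    12 * ∑ᵗ (symmetrisedAt G P4) + 4 * ∑ᵗ (symmetrisedAt G K₁₃)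
      ≡⟨ cong₂ (λ p s → 12 * p + 4 * s) (∑ᵗ-symmetrisedAt G P4) (∑ᵗ-symmetrisedAt G K₁₃) ⟩
    12 * (24 * injHom P4 G) + 4 * (24 * injHom K₁₃ G) ∎
    where
    open ≡-Reasoning
    connected4 : Tuple n → ℕ
    connected4 v = ⟦ distinct v ∧ isConnected G (tupleSet v) ⟧
    ∑ᵗ-linear : ∀ a b (f g : Tuple n → ℕ) → ∑ᵗ (λ v → a * f v + b * g v) ≡ a * ∑ᵗ f + b * ∑ᵗ g
    ∑ᵗ-linear a b f g = trans (∑ᵛ-distrib-+ 4 (λ v → a * f v) (λ v → b * g v)) (cong₂ _+_ (∑ᵛ-*ˡ 4 a f) (∑ᵛ-*ˡ 4 b g))

module _ {n} (G : Graph n) where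

  private
    flip : ∀ {x y} → adj G x y ≡ true → adj G y x ≡ true
    flip {x} {y} = trans (Graph.sym G y x)

    adj-≢ : ∀ {x y} → adj G x y ≡ true → x ≢ y
    adj-≢ {x} xy refl = case trans (sym xy) (irref G x) of λ ()

    isInjHom-pattern : ∀ H v → Distinct v → isInjHom H G v ≡ homCheck (adj H) _==_ (edge (patternOf G v))
    isInjHom-pattern H v inj = isInjHom-permute G H v inj []

  path : Tuple n → Bool
  path (a ∷ b ∷ c ∷ d ∷ []) = (adj G d c ∧ (adj G c ∖ d) b) ∧ (adj G b ∖ c) a

  star : Tuple n → Bool
  star (a ∷ b ∷ c ∷ d ∷ []) = (adj G d c ∧ (adj G d ∖ c) b) ∧ ((adj G d ∖ c) ∖ b) a

  isInjHom-P4 : TriangleFree G → ∀ v → isInjHom P4 G v ≡ path v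
  isInjHom-P4 triangle-free v@(a ∷ b ∷ c ∷ d ∷ []) = ⇔→≡ {z = true} (mk⇔ to from)
    where
    to : isInjHom P4 G v ≡ true → path v ≡ true
    to h = cong₂ _∧_ (cong₂ _∧_ (flip cd) (∖-intro (adj G c) (flip bc) λ e → case inj {1F} {3F} e of λ ()))
                     (∖-intro (adj G b) (flip ab) λ e → case inj {0F} {2F} e of λ ())
      where
      inj = isInjHom-distinct P4 G v h
      abcd = trans (sym (trans (isInjHom-pattern P4 v inj) (homCheck-P4 (patternOf G v)))) h
      ab = ∧-elimˡ abcd
      bc = ∧-elimˡ (∧-elimʳ (adj G a b) abcd)
      cd = ∧-elimʳ (adj G b c) (∧-elimʳ (adj G a b) abcd)
    from : path v ≡ true → isInjHom P4 G v ≡ true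
    from h with ∖-elim (adj G c) d b (∧-elimʳ (adj G d c) (∧-elimˡ h))
              | ∖-elim (adj G b) c a (∧-elimʳ (adj G d c ∧ (adj G c ∖ d) b) h)
    ... | cb , b≢d | ba , a≢c =
      trans (isInjHom-pattern P4 v inj) (trans (homCheck-P4 (patternOf G v)) (cong₂ _∧_ (flip ba) (cong₂ _∧_ (flip cb) (flip dc))))
      where
      dc = ∧-elimˡ (∧-elimˡ h)
      a≢d : a ≢ d
      a≢d refl = triangle-free a b c (flip ba) (flip cb) dc
      inj = distinct-4 (adj-≢ (flip ba)) a≢c a≢d (adj-≢ (flip cb)) b≢d (adj-≢ (flip dc))

  isInjHom-K₁₃ : ∀ v → isInjHom K₁₃ G v ≡ star v
  isInjHom-K₁₃ v@(a ∷ b ∷ c ∷ d ∷ []) = ⇔→≡ {z = true} (mk⇔ to from)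
    where
    to : isInjHom K₁₃ G v ≡ true → star v ≡ true
    to h = cong₂ _∧_ (cong₂ _∧_ (flip cd) (∖-intro (adj G d) (flip bd) λ e → case inj {1F} {2F} e of λ ()))
                     (∖-intro (adj G d ∖ c) (∖-intro (adj G d) (flip ad) λ e → case inj {0F} {2F} e of λ ())
                       λ e → case inj {0F} {1F} e of λ ())
      where
      inj = isInjHom-distinct K₁₃ G v h
      abcd = trans (sym (trans (isInjHom-pattern K₁₃ v inj) (homCheck-K₁₃ (patternOf G v)))) h
      ad = ∧-elimˡ abcd
      bd = ∧-elimˡ (∧-elimʳ (adj G a d) abcd)
      cd = ∧-elimʳ (adj G b d) (∧-elimʳ (adj G a d) abcd)
    from : star v ≡ true → isInjHom K₁₃ G v ≡ true
    from h with ∖-elim (adj G d) c b (∧-elimʳ (adj G d c) (∧-elimˡ h))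
              | ∖-elim (adj G d ∖ c) b a (∧-elimʳ (adj G d c ∧ (adj G d ∖ c) b) h)
    ... | db , b≢c | da∖c , a≢b with ∖-elim (adj G d) c a da∖c
    ... | da , a≢c =
      trans (isInjHom-pattern K₁₃ v inj) (trans (homCheck-K₁₃ (patternOf G v)) (cong₂ _∧_ (flip da) (cong₂ _∧_ (flip db) (flip dc))))
      where
      dc = ∧-elimˡ (∧-elimˡ h)
      inj = distinct-4 a≢b a≢c (adj-≢ (flip da)) b≢c (adj-≢ (flip db)) (adj-≢ (flip dc))

  module _ {k} (regular : Regular k G) where

    private
      degree≡k : ∀ u → count (adj G u) ≡ k
      degree≡k u = trans (sym (countB-allFin (adj G u))) (regular u)

      vertices : count {n} (λ _ → true) ≡ n
      vertices = trans (∑-const n 1) (*-identityʳ n)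

    injHom-P4 : TriangleFree G → injHom P4 G ≡ n * (k * ((k ∸ 1) * ((k ∸ 1) * 1)))
    injHom-P4 triangle-free = begin
      injHom P4 G                ≡⟨ countB-allMaps (isInjHom P4 G) ⟩
      ∑ᵗ (⟦_⟧ ∘ isInjHom P4 G)   ≡⟨ ∑ᵛ-cong 4 (cong ⟦_⟧ ∘ isInjHom-P4 triangle-free) ⟩
      ∑ᵗ (⟦_⟧ ∘ path)            ≡⟨ nested-count (λ _ → true) (adj G) (λ d c → adj G c ∖ d) (λ d c b → adj G b ∖ c)
                                      vertices (λ d _ → degree≡k d)
                                      (λ d c dc → count-∖ (adj G c) (flip dc) (degree≡k c))
                                      (λ d c b h → count-∖ (adj G b) (flip (∧-elimˡ (∧-elimʳ (adj G d c) h))) (degree≡k b)) ⟩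
      n * (k * ((k ∸ 1) * ((k ∸ 1) * 1))) ∎
      where open ≡-Reasoning

    injHom-K₁₃ : injHom K₁₃ G ≡ n * (k * ((k ∸ 1) * ((k ∸ 1 ∸ 1) * 1)))
    injHom-K₁₃ = begin
      injHom K₁₃ G                ≡⟨ countB-allMaps (isInjHom K₁₃ G) ⟩
      ∑ᵗ (⟦_⟧ ∘ isInjHom K₁₃ G)   ≡⟨ ∑ᵛ-cong 4 (cong ⟦_⟧ ∘ isInjHom-K₁₃) ⟩
      ∑ᵗ (⟦_⟧ ∘ star)             ≡⟨ nested-count (λ _ → true) (adj G) (λ d c → adj G d ∖ c) (λ d c b → (adj G d ∖ c) ∖ b)
                                       vertices (λ d _ → degree≡k d)
                                       (λ d c dc → count-∖ (adj G d) dc (degree≡k d))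
                                       (λ d c b h → count-∖ (adj G d ∖ c) (∧-elimʳ (adj G d c) h)
                                                      (count-∖ (adj G d) (∧-elimˡ h) (degree≡k d))) ⟩
      n * (k * ((k ∸ 1) * ((k ∸ 1 ∸ 1) * 1))) ∎
      where open ≡-Reasoning

theorem3p4 : (k n : ℕ) → 0 < k → 0 < n →
    (G G' : Graph n) →
    Regular k G → Bipartite G →
    Regular k G' → Bipartite G' →
    SameQ G G' →
    (subCount C4 G ≡ subCount C4 G') × (subCount P4 G ≡ subCount P4 G')
theorem3p4 k n _ _ G G′ regular bipartite regular′ bipartite′ sameQ =
  cong (_div injHom C4 C4) same-C4 , cong (_div injHom P4 P4) same-P4
  where
  triangle-free = bipartite⇒triangleFree G bipartite
  triangle-free′ = bipartite⇒triangleFree G′ bipartite′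
  same-P4 : injHom P4 G ≡ injHom P4 G′
  same-P4 = trans (injHom-P4 G regular triangle-free) (sym (injHom-P4 G′ regular′ triangle-free′))
  same-K₁₃ : injHom K₁₃ G ≡ injHom K₁₃ G′
  same-K₁₃ = trans (injHom-K₁₃ G regular) (sym (injHom-K₁₃ G′ regular′))
  same-C4 : injHom C4 G ≡ injHom C4 G′
  same-C4 = *-cancelˡ-≡ _ _ 24 (*-cancelˡ-≡ _ _ 9 (+-cancelˡ-≡ (24 * (24 * Qcoeff G 4 1)) _ _ (begin
    24 * (24 * Qcoeff G 4 1) + 9 * (24 * injHom C4 G)      ≡⟨ subgraph-identity G triangle-free ⟩
    12 * (24 * injHom P4 G) + 4 * (24 * injHom K₁₃ G)      ≡⟨ cong₂ (λ p s → 12 * (24 * p) + 4 * (24 * s)) same-P4 same-K₁₃ ⟩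
    12 * (24 * injHom P4 G′) + 4 * (24 * injHom K₁₃ G′)    ≡⟨ subgraph-identity G′ triangle-free′ ⟨
    24 * (24 * Qcoeff G′ 4 1) + 9 * (24 * injHom C4 G′)    ≡⟨ cong (λ q → 24 * (24 * q) + 9 * (24 * injHom C4 G′)) (sameQ 4 1) ⟨
    24 * (24 * Qcoeff G 4 1) + 9 * (24 * injHom C4 G′)    ∎)))
    where open ≡-Reasoning
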